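{- Let $\mathbb{K}$ be a finite field with $|\mathbb{K}|\leq 50$. If $\mathbb{K}$ has characteristic $2$ then $\ell_{\mathbb{K}}\geq 3(|\mathbb{K}|-1)$. If $\mathbb{K}$ has characteristic different from $2$ then $\ell_{\mathbb{K}}\geq \frac{3}{2}(|\mathbb{K}|-1)$.
   Context: For a commutative unital ring $A$ and $a_1,\ldots,a_n\in A$ set $M_n(a_1,\ldots,a_n)=\begin{pmatrix} a_n & -1_A\\ 1_A & 0_A\end{pmatrix}\cdots\begin{pmatrix} a_1 & -1_A\\ 1_A & 0_A\end{pmatrix}$. An $n$-tuple is a $\lambda$-quiddity if $M_n(a_1,\ldots,a_n)=\pm \mathrm{Id}$. For tuples, $(a_1,\ldots,a_n)\oplus(b_1,\ldots,b_m)=(a_1+b_m,a_2,\ldots,a_{n-1},a_n+b_1,b_2,\ldots,b_{m-1})$. Write $(a_1,\ldots,a_n)\sim(b_1,\ldots,b_n)$ if $(b_1,\ldots,b_n)$ is obtained from $(a_1,\ldots,a_n)$ or from $(a_n,\ldots,a_1)$ by a cyclic permutation. A $\lambda$-quiddity $(c_1,\ldots,c_n)$ with $n\geq 3$ is reducible if there exist a $\lambda$-quiddity $(b_1,\ldots,b_l)$ and a tuple $(a_1,\ldots,a_m)$ with $l,m\geq 3$ and $(c_1,\ldots,c_n)\sim(a_1,\ldots,a_m)\oplus(b_1,\ldots,b_l)$; otherwise irreducible. For finite $A$ there are finitely many irreducible $\lambda$-quiddities, and $\ell_A$ denotes their maximal size. -}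

module Defs where

open import Level using (Level; _⊔_)
open import Algebra.Bundles using (CommutativeRing)
open import Data.Nat using (ℕ; zero; suc; _≤_)
open import Data.Fin using (Fin)
open import Data.List using (List; []; _∷_; length; reverse; _++_; [_])
open import Data.List.Relation.Binary.Pointwise using (Pointwise)
open import Data.Product using (Σ; ∃; ∃-syntax; _×_; _,_)
open import Data.Sum using (_⊎_)
open import Relation.Nullary using (¬_)
open import Relation.Binary.PropositionalEquality using (_≡_)

module _ {c ℓ : Level} (A : CommutativeRing c ℓ) where
  open CommutativeRing A

  IsField : Set (c ⊔ ℓ)
  IsField = (¬ (1# ≈ 0#)) × (∀ x → ¬ (x ≈ 0#) → ∃[ y ] (x * y ≈ 1#))

  HasCardinality : ℕ → Set (c ⊔ ℓ)
  HasCardinality q = Σ (Fin q → Carrier) λ f →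
    (∀ i j → f i ≈ f j → i ≡ j) × (∀ x → ∃[ i ] (f i ≈ x))

  Char2 : Set ℓ
  Char2 = (1# + 1#) ≈ 0#

  record Mat : Set c where
    constructor mat
    field
      m11 m12 m21 m22 : Carrier

  _⊗_ : Mat → Mat → Mat
  mat a b c' d ⊗ mat e f g h =
    mat (a * e + b * g) (a * f + b * h) (c' * e + d * g) (c' * f + d * h)

  Id : Mat
  Id = mat 1# 0# 0# 1#

  _≈M_ : Mat → Mat → Set ℓ
  mat a b c' d ≈M mat e f g h = (a ≈ e) × (b ≈ f) × (c' ≈ g) × (d ≈ h)

  negM : Mat → Mat
  negM (mat a b c' d) = mat (- a) (- b) (- c') (- d)

  Ma : Carrier → Mat
  Ma a = mat a (- 1#) 1# 0#

  Mn : List Carrier → Mat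
  Mn []       = Id
  Mn (a ∷ as) = Mn as ⊗ Ma a

  IsQuiddity : List Carrier → Set ℓ
  IsQuiddity as = (Mn as ≈M Id) ⊎ (Mn as ≈M negM Id)

  last? : Carrier → List Carrier → Carrier
  last? d []       = d
  last? d (x ∷ xs) = last? x xs

  init : List Carrier → List Carrier
  init []           = []
  init (x ∷ [])     = []
  init (x ∷ y ∷ xs) = x ∷ init (y ∷ xs)

  -- (a₁,…,a_m) ⊕ (b₁,…,b_l)
  --   = (a₁ + b_l, a₂, …, a_{m-1}, a_m + b₁, b₂, …, b_{l-1})
  -- (only used for m, l ≥ 3)
  _⊕_ : List Carrier → List Carrier → List Carrier
  [] ⊕ bs = bs
  (a ∷ as) ⊕ [] = a ∷ as
  (a ∷ as) ⊕ (b ∷ bs) =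
    (a + last? b bs) ∷ (init as ++ (last? a as + b) ∷ init bs)

  rotate : ℕ → List Carrier → List Carrier
  rotate zero    xs       = xs
  rotate (suc k) []       = []
  rotate (suc k) (x ∷ xs) = rotate k (xs ++ [ x ])

  _≋_ : List Carrier → List Carrier → Set (c ⊔ ℓ)
  _≋_ = Pointwise _≈_

  _∼_ : List Carrier → List Carrier → Set (c ⊔ ℓ)
  as ∼ bs = ∃[ k ] ((bs ≋ rotate k as) ⊎ (bs ≋ rotate k (reverse as)))

  IsReducible : List Carrier → Set (c ⊔ ℓ)
  IsReducible cs = 3 ≤ length cs × ∃[ bs ] ∃[ as ]
    (IsQuiddity bs × 3 ≤ length bs × 3 ≤ length as × cs ∼ (as ⊕ bs))

  IsIrreducibleQuiddity : List Carrier → Set (c ⊔ ℓ)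
  IsIrreducibleQuiddity cs = 3 ≤ length cs × IsQuiddity cs × ¬ IsReducible cs

  -- ℓ_A ≥ N  (ℓ_A = max size of an irreducible λ-quiddity)
  ℓ≥ : ℕ → Set (c ⊔ ℓ)
  ℓ≥ N = ∃[ cs ] (IsIrreducibleQuiddity cs × N ≤ length cs)

module Submission where

-- Let p be the characteristic of K. Extending F_p-independent families gives q = p ^ k, and x ^ q = x
-- for all x. A certified factorisation of X ^ q - X over F_p then produces a root α in K of a chosen
-- monic m of degree k (each factor either has its roots in a small subfield or is mapped onto m by a
-- polynomial), so evaluation at α carries computations in F_p[X]/(m) into K. For each prime power
-- q ≤ 50 a table gives a triple (a, b, c) whose repetition, of length 3 (q - 1) for p = 2 and
-- 3 (q - 1) / 2 otherwise, is checked by computation to be a λ-quiddity none of whose rotations, nor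
-- those of its reverse, ends in a block w with M(w)₁₁ = ±1; a reducible λ-quiddity always has such a
-- block, the interior of its λ-quiddity summand.

open import Level using (_⊔_)
open import Algebra.Bundles using (CommutativeRing)
open import Data.Bool using (Bool; true; false; T; _∧_; if_then_else_)
open import Data.Bool.ListAction using (all)
open import Data.Bool.Properties using (T-∧)
open import Data.Empty using (⊥-elim)
open import Data.Fin as Fin using (Fin; toℕ)
import Data.Fin.Properties as FinP
open import Data.Fin.Permutation using (permutation)
open import Data.List using (List; []; _∷_; length; map; take; drop; _++_; reverse; concat; replicate; find)
import Data.List.Properties as ListP
open import Data.List.Relation.Binary.Pointwise using (Pointwise; []; _∷_; Pointwise-length)
open import Data.List.Relation.Unary.Any using (Any; here; there)
open import Data.Maybe using (maybe′)
open import Data.Nat as ℕ using (ℕ; zero; suc; z≤n; s≤s; NonZero; _<_; _≤_)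
open import Data.Nat.DivMod
  using (_%_; _/_; m≡m%n+[m/n]*n; m%n<n; [m+kn]%n≡m%n; m<n⇒m%n≡m; +-distrib-/; m<n⇒m/n≡0; m*n/n≡m; m*n%n≡0; m<n*o⇒m/o<n)
open import Data.Nat.Divisibility using (divides)
open import Data.Nat.Induction using (<-wellFounded)
open import Data.Nat.Primality using (Prime; prime; composite; prime?; prime⇒nonZero; prime⇒nonTrivial)
import Data.Nat.Properties as ℕP
open import Data.Product using (∃-syntax; _×_; _,_; proj₁; proj₂)
open import Data.Sum as Sum using (_⊎_; inj₁; inj₂)
open import Data.Unit using (tt)
open import Function using (Equivalence)
open import Induction.WellFounded using (Acc; acc)
open import Relation.Binary.Definitions using (DecidableEquality; tri<; tri≈; tri>)
open import Relation.Binary.PropositionalEquality as ≡ using (_≡_; _≢_)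
open import Relation.Nullary using (¬_; Dec; yes; no)
open import Relation.Nullary.Decidable using (map′; ⌊_⌋; _×-dec_; _⊎-dec_; _→-dec_; T?; toWitness)
open import Relation.Unary using (Decidable)
open import Defs

minimal-witness : ∀ {a} {P : ℕ → Set a} → Decidable P →
                  ∀ n → P n → ∃[ m ] (P m × ∀ {k} → k < m → ¬ P k)
minimal-witness {P = P} P? n Pn = search n Pn (<-wellFounded n)
  where
  search : ∀ n → P n → Acc _<_ n → ∃[ m ] (P m × ∀ {k} → k < m → ¬ P k)
  search n Pn (acc smaller) with ℕP.anyUpTo? P? n
  ... | yes (k , k<n , Pk) = search k Pk (smaller k<n)
  ... | no none            = n , Pn , λ k<n Pk → none (_ , k<n , Pk)

module BaseDigits (p : ℕ) .{{_ : NonZero p}} where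

  -- The k base-p digits of s a + t b, each computed modulo p.
  combine : ℕ → ℕ → ℕ → ℕ → ℕ → ℕ
  combine zero    s t a b = 0
  combine (suc k) s t a b =
    (s ℕ.* (a % p) ℕ.+ t ℕ.* (b % p)) % p ℕ.+ combine k s t (a / p) (b / p) ℕ.* p

  digit-split : ∀ {d} c → d < p → (d ℕ.+ c ℕ.* p) % p ≡ d × (d ℕ.+ c ℕ.* p) / p ≡ c
  digit-split {d} c d<p = ≡.trans ([m+kn]%n≡m%n d c p) (m<n⇒m%n≡m d<p)
                        , ≡.trans (+-distrib-/ d (c ℕ.* p) no-carry) (≡.cong₂ ℕ._+_ (m<n⇒m/n≡0 d<p) (m*n/n≡m c p))
    where
    no-carry : d % p ℕ.+ (c ℕ.* p) % p < p
    no-carry = ≡.subst (_< p) (≡.sym (≡.trans (≡.cong₂ ℕ._+_ (m<n⇒m%n≡m d<p) (m*n%n≡0 c p)) (ℕP.+-identityʳ d))) d<p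

  digits-≡ : ∀ {a b} → a % p ≡ b % p → a / p ≡ b / p → a ≡ b
  digits-≡ {a} {b} %≡ /≡ = begin
    a                        ≡⟨ m≡m%n+[m/n]*n a p ⟩
    a % p ℕ.+ (a / p) ℕ.* p  ≡⟨ ≡.cong₂ (λ u v → u ℕ.+ v ℕ.* p) %≡ /≡ ⟩
    b % p ℕ.+ (b / p) ℕ.* p  ≡⟨ m≡m%n+[m/n]*n b p ⟨
    b                        ∎
    where open ≡.≡-Reasoning

  two-digits-< : ∀ {i j} → i < p → j < p → i ℕ.+ j ℕ.* p < p ℕ.* p
  two-digits-< {i} {j} i<p j<p = ℕP.<-≤-trans (ℕP.+-monoˡ-< (j ℕ.* p) i<p) (ℕP.*-monoˡ-≤ p j<p)

  combine-< : ∀ k s t a b → combine k s t a b < p ℕ.^ k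
  combine-< zero    s t a b = s≤s z≤n
  combine-< (suc k) s t a b = begin-strict
    d ℕ.+ hi ℕ.* p                 <⟨ ℕP.+-monoˡ-< (hi ℕ.* p) (m%n<n _ p) ⟩
    p ℕ.+ hi ℕ.* p                 ≡⟨⟩
    suc hi ℕ.* p                   ≤⟨ ℕP.*-monoˡ-≤ p (combine-< k s t (a / p) (b / p)) ⟩
    p ℕ.^ k ℕ.* p                 ≡⟨ ℕP.*-comm (p ℕ.^ k) p ⟩
    p ℕ.^ suc k                   ∎
    where
    open ℕP.≤-Reasoning
    d = (s ℕ.* (a % p) ℕ.+ t ℕ.* (b % p)) % p
    hi = combine k s t (a / p) (b / p)

n<m^n : ∀ {m} → 1 < m → ∀ n → n < m ℕ.^ n
n<m^n         1<m zero    = s≤s z≤n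
n<m^n {m@(suc _)} 1<m (suc n) = ℕP.<-≤-trans (s≤s (n<m^n 1<m n))
  (ℕP.≤-trans (ℕP.m<m*n (m ℕ.^ n) m {{ℕP.m^n≢0 m n}} 1<m) (ℕP.≤-reflexive (ℕP.*-comm (m ℕ.^ n) m)))

-- Finite fields: characteristic, Fermat's little theorem, q = p ^ k

module FieldProperties {c ℓ} (K : CommutativeRing c ℓ) (isField : IsField K) where
  open CommutativeRing K
  open import Relation.Binary.Reasoning.Setoid setoid

  1≉0 : ¬ 1# ≈ 0#
  1≉0 = proj₁ isField

  x≉0∧xy≈0⇒y≈0 : ∀ {x y} → ¬ x ≈ 0# → x * y ≈ 0# → y ≈ 0#
  x≉0∧xy≈0⇒y≈0 {x} {y} x≉0 xy≈0 with proj₂ isField x x≉0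
  ... | x⁻¹ , xx⁻¹≈1 = begin
    y              ≈⟨ *-identityˡ y ⟨
    1# * y         ≈⟨ *-congʳ (trans (*-comm x⁻¹ x) xx⁻¹≈1) ⟨
    (x⁻¹ * x) * y  ≈⟨ *-assoc x⁻¹ x y ⟩
    x⁻¹ * (x * y)  ≈⟨ *-congˡ xy≈0 ⟩
    x⁻¹ * 0#       ≈⟨ zeroʳ x⁻¹ ⟩
    0#             ∎

  *-≉0 : ∀ {x y} → ¬ x ≈ 0# → ¬ y ≈ 0# → ¬ x * y ≈ 0#
  *-≉0 x≉0 y≉0 xy≈0 = y≉0 (x≉0∧xy≈0⇒y≈0 x≉0 xy≈0)

  *-cancelˡ-≉0 : ∀ {x y z} → ¬ x ≈ 0# → x * y ≈ x * z → y ≈ z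
  *-cancelˡ-≉0 {x} {y} {z} x≉0 xy≈xz = x∙y⁻¹≈ε⇒x≈y y z (x≉0∧xy≈0⇒y≈0 x≉0 (begin
    x * (y - z)    ≈⟨ x[y-z]≈xy-xz x y z ⟩
    x * y - x * z  ≈⟨ x≈y⇒x∙y⁻¹≈ε xy≈xz ⟩
    0#             ∎))
    where open import Algebra.Properties.Ring ring using (x[y-z]≈xy-xz; x∙y⁻¹≈ε⇒x≈y; x≈y⇒x∙y⁻¹≈ε)

module Characteristic {c ℓ} (K : CommutativeRing c ℓ) where
  open CommutativeRing K
  open import Algebra.Properties.Semiring.Mult semiring using (×-homo-+; ×1-homo-*) renaming (_×_ to _·_)
  open import Algebra.Properties.Semiring.Exp semiring using (_^_)
  open import Algebra.Properties.Ring ring using (+-identityʳ-unique; -1*x≈-x; +-inverseʳ-unique)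
  open import Relation.Binary.Reasoning.Setoid setoid

  record IsCharacteristic (p : ℕ) : Set ℓ where
    field
      positive    : 0 < p
      annihilates : p · 1# ≈ 0#
      minimal     : ∀ {k} → 0 < k → k < p → ¬ k · 1# ≈ 0#

  ≈⇒∸·1≈0 : ∀ {a b} → a ≤ b → a · 1# ≈ b · 1# → (b ℕ.∸ a) · 1# ≈ 0#
  ≈⇒∸·1≈0 {a} {b} a≤b a≈b = +-identityʳ-unique (a · 1#) _ (begin
    a · 1# + (b ℕ.∸ a) · 1#  ≈⟨ ×-homo-+ 1# a (b ℕ.∸ a) ⟨
    (a ℕ.+ (b ℕ.∸ a)) · 1#   ≡⟨ ≡.cong (_· 1#) (ℕP.m+[n∸m]≡n a≤b) ⟩
    b · 1#                   ≈⟨ a≈b ⟨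
    a · 1#                   ∎)

  ·1-homo-^ : ∀ m n → (m ℕ.^ n) · 1# ≈ (m · 1#) ^ n
  ·1-homo-^ m zero    = +-identityʳ 1#
  ·1-homo-^ m (suc n) = trans (×1-homo-* m (m ℕ.^ n)) (*-congˡ (·1-homo-^ m n))

  module _ {p} (char : IsCharacteristic p) where
    open IsCharacteristic char

    instance
      p-nonZero : NonZero p
      p-nonZero = ℕ.>-nonZero positive

    ·1-% : ∀ n → (n % p) · 1# ≈ n · 1#
    ·1-% n = sym (begin
      n · 1#                               ≡⟨ ≡.cong (_· 1#) (m≡m%n+[m/n]*n n p) ⟩
      (n % p ℕ.+ (n / p) ℕ.* p) · 1#       ≈⟨ ×-homo-+ 1# (n % p) _ ⟩
      (n % p) · 1# + ((n / p) ℕ.* p) · 1#    ≈⟨ +-congˡ (×1-homo-* (n / p) p) ⟩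
      (n % p) · 1# + (n / p) · 1# * p · 1#   ≈⟨ +-congˡ (trans (*-congˡ annihilates) (zeroʳ _)) ⟩
      (n % p) · 1# + 0#                      ≈⟨ +-identityʳ _ ⟩
      (n % p) · 1#                           ∎)

    ·1-injective : ∀ {a b} → a < p → b < p → a · 1# ≈ b · 1# → a ≡ b
    ·1-injective {a} {b} a<p b<p a≈b with ℕP.<-cmp a b
    ... | tri≈ _ a≡b _ = a≡b
    ... | tri< a<b _ _ = ⊥-elim (minimal (ℕP.m<n⇒0<n∸m a<b)
                                  (ℕP.≤-<-trans (ℕP.m∸n≤m b a) b<p) (≈⇒∸·1≈0 (ℕP.<⇒≤ a<b) a≈b))
    ... | tri> _ _ b<a = ⊥-elim (minimal (ℕP.m<n⇒0<n∸m b<a)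
                                  (ℕP.≤-<-trans (ℕP.m∸n≤m a b) a<p) (≈⇒∸·1≈0 (ℕP.<⇒≤ b<a) (sym a≈b)))

    [p-1]·1≈-1 : (p ℕ.∸ 1) · 1# ≈ - 1#
    [p-1]·1≈-1 = +-inverseʳ-unique 1# _ (begin
      1# + (p ℕ.∸ 1) · 1#       ≡⟨⟩
      (1 ℕ.+ (p ℕ.∸ 1)) · 1#    ≡⟨ ≡.cong (_· 1#) (ℕP.m+[n∸m]≡n positive) ⟩
      p · 1#                    ≈⟨ annihilates ⟩
      0#                        ∎)

    [p-1]*n·1≈-n·1 : ∀ n → ((p ℕ.∸ 1) ℕ.* n) · 1# ≈ - (n · 1#)
    [p-1]*n·1≈-n·1 n = begin
      ((p ℕ.∸ 1) ℕ.* n) · 1#       ≈⟨ ×1-homo-* (p ℕ.∸ 1) n ⟩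
      (p ℕ.∸ 1) · 1# * n · 1#      ≈⟨ *-congʳ [p-1]·1≈-1 ⟩
      - 1# * n · 1#                ≈⟨ -1*x≈-x _ ⟩
      - (n · 1#)                   ∎

    module _ (isField : IsField K) where
      open FieldProperties K isField

      1<characteristic : 1 < p
      1<characteristic = ℕP.≤∧≢⇒< positive λ 1≡p →
        1≉0 (trans (sym (+-identityʳ 1#)) (≡.subst (λ n → n · 1# ≈ 0#) (≡.sym 1≡p) annihilates))

      characteristic-prime : Prime p
      characteristic-prime = prime {{ℕ.n>1⇒nonTrivial 1<characteristic}} not-composite
        where
        not-composite : ¬ _
        not-composite (composite {d} d<p (divides e p≡e*d)) = minimal 0<e e<p e≈0
          where
          1<d : 1 < d
          1<d = ℕ.nonTrivial⇒n>1 d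
          0<e : 0 < e
          0<e = ℕP.n≢0⇒n>0 λ e≡0 → ℕP.<⇒≢ positive (≡.sym (≡.trans p≡e*d (≡.cong (ℕ._* d) e≡0)))
          e<p : e < p
          e<p = ℕP.<-≤-trans (ℕP.m<m*n e d {{ℕ.>-nonZero 0<e}} 1<d) (ℕP.≤-reflexive (≡.sym p≡e*d))
          e≈0 : e · 1# ≈ 0#
          e≈0 = x≉0∧xy≈0⇒y≈0 (minimal (ℕP.<-trans (s≤s z≤n) 1<d) d<p) (begin
            d · 1# * e · 1#   ≈⟨ *-comm _ _ ⟩
            e · 1# * d · 1#   ≈⟨ ×1-homo-* e d ⟨
            (e ℕ.* d) · 1#    ≡⟨ ≡.cong (_· 1#) (≡.sym p≡e*d) ⟩
            p · 1#            ≈⟨ annihilates ⟩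
            0#                ∎)

      Char2⇒p≡2 : Char2 K → p ≡ 2
      Char2⇒p≡2 char2 with ℕP.<-cmp p 2
      ... | tri< p<2 _ _ = ⊥-elim (ℕP.<⇒≱ p<2 1<characteristic)
      ... | tri≈ _ p≡2 _ = p≡2
      ... | tri> _ _ 2<p = ⊥-elim (minimal (s≤s z≤n) 2<p (trans (+-congˡ (+-identityʳ 1#)) char2))

    p≡2⇒Char2 : p ≡ 2 → Char2 K
    p≡2⇒Char2 ≡.refl = trans (+-congˡ (sym (+-identityʳ 1#))) annihilates

module FiniteField {c ℓ} (K : CommutativeRing c ℓ) (isField : IsField K) {q : ℕ} (card : HasCardinality K q) where
  open CommutativeRing K
  open FieldProperties K isField
  open Characteristic K
  open import Algebra.Properties.Semiring.Mult semiring using (×-homo-+; ×1-homo-*) renaming (_×_ to _·_)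
  open import Algebra.Properties.Semiring.Exp semiring using (_^_)
  open import Algebra.Properties.CommutativeMonoid.Sum *-commutativeMonoid
    using (sum-remove; sum-cong-≋; sum-replicate; sum-permute; ∑-distrib-+) renaming (sum to ∏)
  open import Relation.Binary.Reasoning.Setoid setoid

  element : Fin q → Carrier
  element = proj₁ card

  element-injective : ∀ {i j} → element i ≈ element j → i ≡ j
  element-injective = proj₁ (proj₂ card) _ _

  index : Carrier → Fin q
  index x = proj₁ (proj₂ (proj₂ card) x)

  element-index : ∀ x → element (index x) ≈ x
  element-index x = proj₂ (proj₂ (proj₂ card) x)

  index-injective : ∀ {x y} → index x ≡ index y → x ≈ y
  index-injective {x} {y} same = begin
    x                  ≈⟨ element-index x ⟨
    element (index x)  ≡⟨ ≡.cong element same ⟩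
    element (index y)  ≈⟨ element-index y ⟩
    y                  ∎

  _≟_ : ∀ x y → Dec (x ≈ y)
  x ≟ y = map′ index-injective
    (λ x≈y → element-injective (trans (element-index x) (trans x≈y (sym (element-index y)))))
    (index x Fin.≟ index y)

  *-integral : ∀ {x y} → x * y ≈ 0# → x ≈ 0# ⊎ y ≈ 0#
  *-integral {x} xy≈0 with x ≟ 0#
  ... | yes x≈0 = inj₁ x≈0
  ... | no  x≉0 = inj₂ (x≉0∧xy≈0⇒y≈0 x≉0 xy≈0)

  2≤q : 2 ≤ q
  2≤q = FinP.injective⇒≤ {f = zero-one} injective
    where
    zero-one : Fin 2 → Fin q
    zero-one Fin.zero    = index 0#
    zero-one (Fin.suc _) = index 1#
    injective : ∀ {i j} → zero-one i ≡ zero-one j → i ≡ j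
    injective {Fin.zero}          {Fin.zero}          _    = ≡.refl
    injective {Fin.zero}          {Fin.suc Fin.zero}  same = ⊥-elim (1≉0 (sym (index-injective same)))
    injective {Fin.suc Fin.zero}  {Fin.zero}          same = ⊥-elim (1≉0 (index-injective same))
    injective {Fin.suc Fin.zero}  {Fin.suc Fin.zero}  _    = ≡.refl

  outside-image : ∀ {s} (g : Fin s → Carrier) → s < q → ∃[ x ] (∀ t → ¬ g t ≈ x)
  outside-image {s} g s<q with FinP.all? (λ i → FinP.any? (λ t → g t ≟ element i))
  ... | yes onto = ⊥-elim (ℕP.<⇒≱ s<q (FinP.injective⇒≤ {f = λ i → proj₁ (onto i)} injective))
    where
    injective : ∀ {i j} → proj₁ (onto i) ≡ proj₁ (onto j) → i ≡ j
    injective {i} {j} same = element-injective (begin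
      element i              ≈⟨ proj₂ (onto i) ⟨
      g (proj₁ (onto i))     ≡⟨ ≡.cong g same ⟩
      g (proj₁ (onto j))     ≈⟨ proj₂ (onto j) ⟩
      element j              ∎)
  ... | no ¬onto with FinP.¬∀⟶∃¬ q _ (λ i → FinP.any? (λ t → g t ≟ element i)) ¬onto
  ...   | i , missed = element i , λ t gt≈x → missed (t , gt≈x)

  ∏-all-but-one : ∀ {n} (t : Fin n → Carrier) (i : Fin n) {x} →
                  t i ≈ 1# → (∀ j → j ≢ i → t j ≈ x) → ∏ t * x ≈ x ^ n
  ∏-all-but-one {suc n} t i {x} tᵢ≈1 others = begin
    ∏ t * x                                  ≈⟨ *-congʳ (sum-remove {i = i} t) ⟩
    (t i * ∏ (λ j → t (Fin.punchIn i j))) * x ≈⟨ *-congʳ (*-cong tᵢ≈1 rest) ⟩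
    (1# * x ^ n) * x                          ≈⟨ *-congʳ (*-identityˡ _) ⟩
    x ^ n * x                                 ≈⟨ *-comm _ _ ⟩
    x ^ suc n                                 ∎
    where
    rest : ∏ (λ j → t (Fin.punchIn i j)) ≈ x ^ n
    rest = trans (sum-cong-≋ (λ j → others _ (FinP.punchInᵢ≢i i j))) (sum-replicate n)

  private
    zero↦1 : Carrier → Carrier
    zero↦1 y with y ≟ 0#
    ... | yes _ = 1#
    ... | no  _ = y

    zero↦1-≉0 : ∀ y → ¬ zero↦1 y ≈ 0#
    zero↦1-≉0 y with y ≟ 0#
    ... | yes _   = 1≉0
    ... | no  y≉0 = y≉0

    zero↦1-cong : ∀ {y z} → y ≈ z → zero↦1 y ≈ zero↦1 z
    zero↦1-cong {y} {z} y≈z with y ≟ 0# | z ≟ 0#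
    ... | yes _   | yes _   = refl
    ... | yes y≈0 | no  z≉0 = ⊥-elim (z≉0 (trans (sym y≈z) y≈0))
    ... | no  y≉0 | yes z≈0 = ⊥-elim (y≉0 (trans y≈z z≈0))
    ... | no  _   | no  _   = y≈z

    unless-zero : Carrier → Carrier → Carrier
    unless-zero y x with y ≟ 0#
    ... | yes _ = 1#
    ... | no  _ = x

    zero↦1-* : ∀ {x} y → ¬ x ≈ 0# → zero↦1 (x * y) ≈ unless-zero y x * zero↦1 y
    zero↦1-* {x} y x≉0 with y ≟ 0# | (x * y) ≟ 0#
    ... | yes _   | yes _    = sym (*-identityˡ 1#)
    ... | yes y≈0 | no  xy≉0 = ⊥-elim (xy≉0 (trans (*-congˡ y≈0) (zeroʳ x)))
    ... | no  y≉0 | yes xy≈0 = ⊥-elim (*-≉0 x≉0 y≉0 xy≈0)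
    ... | no  _   | no  _    = refl

  -- For x ≉ 0, y ↦ x y permutes K, so the products of zero↦1 over K before and after it agree;
  -- their ratio is ∏ s = x ^ (q ∸ 1).
  fermat : ∀ x → x ^ q ≈ x
  fermat x with x ≟ 0#
  ... | yes x≈0 = begin
    x ^ q                        ≡⟨ ≡.cong (x ^_) (≡.sym (ℕP.m+[n∸m]≡n 2≤q)) ⟩
    x * (x * x ^ (q ℕ.∸ 2))      ≈⟨ trans (*-congʳ x≈0) (zeroˡ _) ⟩
    0#                           ≈⟨ x≈0 ⟨
    x                            ∎
  ... | no x≉0 = begin
    x ^ q         ≈⟨ ∏-all-but-one s (index 0#) s₀≈1 sᵢ≈x ⟨
    ∏ s * x       ≈⟨ *-congʳ ∏s≈1 ⟩
    1# * x        ≈⟨ *-identityˡ x ⟩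
    x             ∎
    where
    x⁻¹ = proj₁ (proj₂ isField x x≉0)
    xx⁻¹≈1 : x * x⁻¹ ≈ 1#
    xx⁻¹≈1 = proj₂ (proj₂ isField x x≉0)
    σ τ : Fin q → Fin q
    σ i = index (x * element i)
    τ i = index (x⁻¹ * element i)
    cancels : ∀ a b y → a * b ≈ 1# → a * (b * y) ≈ y
    cancels a b y ab≈1 = trans (sym (*-assoc a b y)) (trans (*-congʳ ab≈1) (*-identityˡ y))
    στ : ∀ i → σ (τ i) ≡ i
    στ i = element-injective (trans (element-index _)
             (trans (*-congˡ (element-index _)) (cancels x x⁻¹ _ xx⁻¹≈1)))
    τσ : ∀ i → τ (σ i) ≡ i
    τσ i = element-injective (trans (element-index _)
             (trans (*-congˡ (element-index _)) (cancels x⁻¹ x _ (trans (*-comm x⁻¹ x) xx⁻¹≈1))))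
    h s : Fin q → Carrier
    h i = zero↦1 (element i)
    s i = unless-zero (element i) x
    s₀≈1 : s (index 0#) ≈ 1#
    s₀≈1 with element (index 0#) ≟ 0#
    ... | yes _   = refl
    ... | no  ≉0 = ⊥-elim (≉0 (element-index 0#))
    sᵢ≈x : ∀ i → i ≢ index 0# → s i ≈ x
    sᵢ≈x i i≢0 with element i ≟ 0#
    ... | yes ≈0 = ⊥-elim (i≢0 (element-injective (trans ≈0 (sym (element-index 0#)))))
    ... | no  _  = refl
    ∏h≈∏sh : ∏ h * 1# ≈ ∏ h * ∏ s
    ∏h≈∏sh = begin
      ∏ h * 1#                  ≈⟨ *-identityʳ _ ⟩
      ∏ h                       ≈⟨ sum-permute h (permutation σ τ στ τσ) ⟩
      ∏ (λ i → h (σ i))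
        ≈⟨ sum-cong-≋ (λ i → trans (zero↦1-cong (element-index _)) (zero↦1-* (element i) x≉0)) ⟩
      ∏ (λ i → s i * h i)       ≈⟨ ∑-distrib-+ s h ⟩
      ∏ s * ∏ h                 ≈⟨ *-comm _ _ ⟩
      ∏ h * ∏ s                 ∎
    ∏s≈1 : ∏ s ≈ 1#
    ∏s≈1 = sym (*-cancelˡ-≉0 (∏-≉0 h (λ i → zero↦1-≉0 (element i))) ∏h≈∏sh)
      where
      ∏-≉0 : ∀ {n} (t : Fin n → Carrier) → (∀ i → ¬ t i ≈ 0#) → ¬ ∏ t ≈ 0#
      ∏-≉0 {zero}  t _     = 1≉0
      ∏-≉0 {suc n} t t≉0 = *-≉0 (t≉0 Fin.zero) (∏-≉0 (λ i → t (Fin.suc i)) (λ i → t≉0 (Fin.suc i)))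

  power-inverse : ∀ {x} → ¬ x ≈ 0# → x ^ (q ℕ.∸ 2) * x ≈ 1#
  power-inverse {x} x≉0 = trans (*-comm _ x) (*-cancelˡ-≉0 x≉0 (begin
    x * (x * x ^ (q ℕ.∸ 2))  ≡⟨ ≡.cong (x ^_) (ℕP.m+[n∸m]≡n 2≤q) ⟩
    x ^ q                    ≈⟨ fermat x ⟩
    x                        ≈⟨ *-identityʳ x ⟨
    x * 1#                   ∎))

  characteristic : ∃[ p ] IsCharacteristic p
  characteristic with FinP.pigeonhole (ℕP.n<1+n q) (λ (i : Fin (suc q)) → index (toℕ i · 1#))
  ... | i , j , i<j , same
    with minimal-witness (λ k → (0 ℕP.<? k) ×-dec ((k · 1#) ≟ 0#)) (toℕ j ℕ.∸ toℕ i)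
           (ℕP.m<n⇒0<n∸m i<j , ≈⇒∸·1≈0 (ℕP.<⇒≤ i<j) (index-injective same))
  ...   | p , (0<p , p·1≈0) , below = p , record
    { positive    = 0<p
    ; annihilates = p·1≈0
    ; minimal     = λ 0<k k<p k·1≈0 → below k<p (0<k , k·1≈0)
    }

  module PrimeSubfield {p} (char : IsCharacteristic p) where
    open IsCharacteristic char
    open BaseDigits p {{p-nonZero char}}
    open import Algebra.Properties.Ring ring using ([y-z]x≈yx-zx; -‿distribˡ-*; -‿distribʳ-*)
    open import Algebra.Solver.Ring.NaturalCoefficients.Default commutativeSemiring
      using (solve; _:=_; _:+_; _:*_)

    private instance
      p≢0 : NonZero p
      p≢0 = p-nonZero char

    ·1-inverse : ∀ {u} → ¬ u · 1# ≈ 0# → ∃[ t ] (t · 1# * u · 1# ≈ 1#)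
    ·1-inverse {u} u≉0 = u ℕ.^ (q ℕ.∸ 2) , trans (*-congʳ (·1-homo-^ u (q ℕ.∸ 2))) (power-inverse u≉0)

    combination : List Carrier → ℕ → Carrier
    combination []       n = 0#
    combination (e ∷ es) n = (n % p) · 1# * e + combination es (n / p)

    combination-combine : ∀ es s t a b → combination es (combine (length es) s t a b)
                                         ≈ s · 1# * combination es a + t · 1# * combination es b
    combination-combine []       s t a b = sym (trans (+-cong (zeroʳ _) (zeroʳ _)) (+-identityˡ 0#))
    combination-combine (e ∷ es) s t a b = begin
      (d′ % p) · 1# * e + combination es (d′ / p)
        ≡⟨ ≡.cong₂ (λ u v → u · 1# * e + combination es v) (proj₁ split) (proj₂ split) ⟩
      d · 1# * e + combination es hi
        ≈⟨ +-cong (*-congʳ d≈) (combination-combine es s t (a / p) (b / p)) ⟩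
      (s·1 * A + t·1 * B) * e + (s·1 * X + t·1 * Y)
        ≈⟨ solve 7 (λ S A T B e X Y → (S :* A :+ T :* B) :* e :+ (S :* X :+ T :* Y)
                                     := S :* (A :* e :+ X) :+ T :* (B :* e :+ Y)) refl s·1 A t·1 B e X Y ⟩
      s·1 * (A * e + X) + t·1 * (B * e + Y) ∎
      where
      d = (s ℕ.* (a % p) ℕ.+ t ℕ.* (b % p)) % p
      hi = combine (length es) s t (a / p) (b / p)
      d′ = d ℕ.+ hi ℕ.* p
      split = digit-split hi (m%n<n _ p)
      s·1 = s · 1#
      t·1 = t · 1#
      A = (a % p) · 1#
      B = (b % p) · 1#
      X = combination es (a / p)
      Y = combination es (b / p)
      d≈ : d · 1# ≈ s·1 * A + t·1 * B
      d≈ = trans (·1-% char _) (trans (×-homo-+ 1# (s ℕ.* (a % p)) _) (+-cong (×1-homo-* s _) (×1-homo-* t _)))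

    Independent : List Carrier → Set ℓ
    Independent es = ∀ {a b} → a < p ℕ.^ length es → b < p ℕ.^ length es →
                     combination es a ≈ combination es b → a ≡ b

    Spans : List Carrier → Carrier → Set ℓ
    Spans es e = ∃[ a ] (a < p ℕ.^ length es × combination es a ≈ e)

    x+y≈z+w⇒x-z≈w-y : ∀ {x y z w} → x + y ≈ z + w → x - z ≈ w - y
    x+y≈z+w⇒x-z≈w-y {x} {y} {z} {w} x+y≈z+w = begin
      x - z                       ≈⟨ +-identityʳ _ ⟨
      (x - z) + 0#                ≈⟨ +-congˡ (-‿inverseʳ y) ⟨
      (x - z) + (y - y)
        ≈⟨ solve 4 (λ x -z y -y → (x :+ -z) :+ (y :+ -y) := (x :+ y) :+ (-z :+ -y)) refl x (- z) y (- y) ⟩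
      (x + y) + (- z - y)         ≈⟨ +-congʳ x+y≈z+w ⟩
      (z + w) + (- z - y)
        ≈⟨ solve 4 (λ z w -z -y → (z :+ w) :+ (-z :+ -y) := (w :+ -y) :+ (z :+ -z)) refl z w (- z) (- y) ⟩
      (w - y) + (z - z)           ≈⟨ +-congˡ (-‿inverseʳ z) ⟩
      (w - y) + 0#                ≈⟨ +-identityʳ _ ⟩
      w - y                       ∎

    -- If the lowest digits A, B of a and b differ, A e + X ≈ B e + Y can be solved for e in the span of es.
    independent-∷ : ∀ es {e} → Independent es → ¬ Spans es e → Independent (e ∷ es)
    independent-∷ es {e} indep e∉ {a} {b} a< b< same with (a % p) ℕ.≟ (b % p)
    ... | yes digit≡ = digits-≡ digit≡ quotient≡
      where
      open import Algebra.Properties.Ring ring using (+-cancelˡ)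
      quotient-< : ∀ {n} → n < p ℕ.^ suc (length es) → n / p < p ℕ.^ length es
      quotient-< {n} n< = m<n*o⇒m/o<n (≡.subst (n <_) (ℕP.*-comm p _) n<)
      quotient≡ : a / p ≡ b / p
      quotient≡ = indep (quotient-< a<) (quotient-< b<)
        (+-cancelˡ _ _ _ (trans same (+-congʳ (*-congʳ (reflexive (≡.cong (_· 1#) (≡.sym digit≡)))))))
    ... | no digit≢ = ⊥-elim (e∉ (e′ , combine-< (length es) t t′ (b / p) (a / p) , sym e≈))
      where
      open import Algebra.Properties.Ring ring using (x∙y⁻¹≈ε⇒x≈y)
      A = (a % p) · 1#
      B = (b % p) · 1#
      X = combination es (a / p)
      Y = combination es (b / p)
      u = a % p ℕ.+ (p ℕ.∸ 1) ℕ.* (b % p)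
      u≈A-B : u · 1# ≈ A - B
      u≈A-B = trans (×-homo-+ 1# (a % p) _) (+-congˡ ([p-1]*n·1≈-n·1 char (b % p)))
      u≉0 : ¬ u · 1# ≈ 0#
      u≉0 u≈0 = digit≢ (·1-injective char (m%n<n a p) (m%n<n b p) (x∙y⁻¹≈ε⇒x≈y _ _ (trans (sym u≈A-B) u≈0)))
      t = proj₁ (·1-inverse {u} u≉0)
      t′ = (p ℕ.∸ 1) ℕ.* t
      e′ = combine (length es) t t′ (b / p) (a / p)
      t·-X≈t′·X : t · 1# * (- X) ≈ t′ · 1# * X
      t·-X≈t′·X = begin
        t · 1# * (- X)     ≈⟨ -‿distribʳ-* (t · 1#) X ⟨
        - (t · 1# * X)     ≈⟨ -‿distribˡ-* (t · 1#) X ⟩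
        - (t · 1#) * X     ≈⟨ *-congʳ ([p-1]*n·1≈-n·1 char t) ⟨
        t′ · 1# * X        ∎
      e≈ : e ≈ combination es e′
      e≈ = begin
        e                              ≈⟨ *-identityˡ e ⟨
        1# * e                         ≈⟨ *-congʳ (proj₂ (·1-inverse {u} u≉0)) ⟨
        (t · 1# * u · 1#) * e          ≈⟨ *-assoc (t · 1#) _ e ⟩
        t · 1# * (u · 1# * e)
          ≈⟨ *-congˡ (trans (*-congʳ u≈A-B) (trans ([y-z]x≈yx-zx e A B) (x+y≈z+w⇒x-z≈w-y same))) ⟩
        t · 1# * (Y - X)               ≈⟨ distribˡ (t · 1#) Y (- X) ⟩
        t · 1# * Y + t · 1# * (- X)    ≈⟨ +-congˡ t·-X≈t′·X ⟩
        t · 1# * Y + t′ · 1# * X       ≈⟨ combination-combine es t t′ (b / p) (a / p) ⟨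
        combination es e′              ∎

    independent-[] : Independent []
    independent-[] (s≤s z≤n) (s≤s z≤n) _ = ≡.refl

    independent⇒≤ : ∀ es → Independent es → p ℕ.^ length es ≤ q
    independent⇒≤ es indep = FinP.injective⇒≤ {f = λ i → index (combination es (toℕ i))}
      (λ same → FinP.toℕ-injective (indep (FinP.toℕ<n _) (FinP.toℕ<n _) (index-injective same)))

    -- An independent list has fewer than q elements, so suc q extensions by elements outside the span suffice.
    spanning-extension : ∀ fuel es → Independent es → length es ℕ.+ fuel ≡ suc q → ∃[ j ] (q ≡ p ℕ.^ j)
    spanning-extension zero es indep len≡ = ⊥-elim (ℕP.<⇒≱ (n<m^n (1<characteristic char isField) (length es))
      (ℕP.≤-trans (independent⇒≤ es indep) (ℕP.≤-trans (ℕP.n≤1+n q)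
        (ℕP.≤-reflexive (≡.trans (≡.sym len≡) (ℕP.+-identityʳ _))))))
    spanning-extension (suc fuel) es indep len≡ with FinP.all? (λ i → FinP.any? (λ a → combination es (toℕ a) ≟ element i))
    ... | yes spanning =
      length es , ℕP.≤-antisym (FinP.injective⇒≤ {f = λ i → proj₁ (spanning i)} injective) (independent⇒≤ es indep)
      where
      injective : ∀ {i j} → proj₁ (spanning i) ≡ proj₁ (spanning j) → i ≡ j
      injective {i} {j} same = element-injective (trans (sym (proj₂ (spanning i)))
        (trans (reflexive (≡.cong (λ a → combination es (toℕ a)) same)) (proj₂ (spanning j))))
    ... | no ¬spanning with FinP.¬∀⟶∃¬ q _ (λ i → FinP.any? (λ a → combination es (toℕ a) ≟ element i)) ¬spanning
    ...   | i , missed = spanning-extension fuel (element i ∷ es) (independent-∷ es indep e∉)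
                           (≡.trans (≡.sym (ℕP.+-suc (length es) fuel)) len≡)
      where
      e∉ : ¬ Spans es (element i)
      e∉ (a , a< , a↦e) = missed (Fin.fromℕ< a< , trans (reflexive (≡.cong (combination es) (FinP.toℕ-fromℕ< a<))) a↦e)

  prime-power : ∃[ p ] ∃[ j ] (IsCharacteristic p × Prime p × q ≡ p ℕ.^ suc j)
  prime-power with characteristic
  ... | p , char with PrimeSubfield.spanning-extension char (suc q) [] (PrimeSubfield.independent-[] char) ≡.refl
  ...   | zero  , q≡1 = ⊥-elim (ℕP.<⇒≢ 2≤q (≡.sym q≡1))
  ...   | suc j , q≡  = p , j , char , characteristic-prime char isField , q≡

-- Polynomials over ℕ, read modulo p and evaluated in K

-- Coefficient lists, constant term first.
Poly : Set
Poly = List ℕ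

infixl 6 _+ᴾ_
infixl 7 _*ᴾ_ _·ᴾ_

_+ᴾ_ : Poly → Poly → Poly
[]      +ᴾ v       = v
(a ∷ u) +ᴾ []      = a ∷ u
(a ∷ u) +ᴾ (b ∷ v) = a ℕ.+ b ∷ u +ᴾ v

_·ᴾ_ : ℕ → Poly → Poly
c ·ᴾ []      = []
c ·ᴾ (a ∷ u) = c ℕ.* a ∷ c ·ᴾ u

_*ᴾ_ : Poly → Poly → Poly
[]      *ᴾ v = []
(a ∷ u) *ᴾ v = a ·ᴾ v +ᴾ (0 ∷ u *ᴾ v)

_∘ᴾ_ : Poly → Poly → Poly
[]      ∘ᴾ g = []
(a ∷ u) ∘ᴾ g = (a ∷ []) +ᴾ g *ᴾ (u ∘ᴾ g)

Xᴾ^_ : ℕ → Poly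
Xᴾ^ zero  = 1 ∷ []
Xᴾ^ suc n = 0 ∷ Xᴾ^ n

monic : Poly → Poly
monic f = f ++ 1 ∷ []

_∷₀_ : ℕ → Poly → Poly
zero  ∷₀ []    = []
zero  ∷₀ u     = 0 ∷ u
suc a ∷₀ u     = suc a ∷ u

trim : Poly → Poly
trim []      = []
trim (a ∷ u) = a ∷₀ trim u

module Modular (p : ℕ) .{{_ : NonZero p}} where

  reduce : Poly → Poly
  reduce = map (_% p)

  negate : Poly → Poly
  negate = map ((p ℕ.∸ 1) ℕ.*_)

  -- Rewrites X^k to r until the degree drops below k; fuel bounds the number of steps.
  reduceBy : ℕ → Poly → ℕ → Poly → Poly
  reduceBy k r zero       u = u
  reduceBy k r (suc fuel) u with length u ℕ.≤ᵇ k
  ... | true  = u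
  ... | false = reduceBy k r fuel (reduce (take k u +ᴾ r *ᴾ drop k u))

  normalForm : ℕ → Poly → Poly → Poly
  normalForm k r u = trim (reduce (reduceBy k r (length u) u))

  normalForm₀ : Poly → Poly
  normalForm₀ u = trim (reduce u)

module Evaluation {c ℓ} (K : CommutativeRing c ℓ) where
  open CommutativeRing K
  open Characteristic K
  open import Algebra.Properties.Semiring.Mult semiring using (×-homo-+; ×1-homo-*) renaming (_×_ to _·_)
  open import Algebra.Properties.Semiring.Exp semiring using (_^_)
  open import Algebra.Properties.Ring ring using (-‿distribʳ-*; -‿+-comm; +-inverseʳ-unique)
  open import Algebra.Solver.Ring.NaturalCoefficients.Default commutativeSemiring
    using (solve; _:=_; _:+_; _:*_)
  open import Relation.Binary.Reasoning.Setoid setoid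

  eval : Carrier → Poly → Carrier
  eval y []      = 0#
  eval y (a ∷ u) = a · 1# + y * eval y u

  eval-constant : ∀ y a → eval y (a ∷ []) ≈ a · 1#
  eval-constant y a = trans (+-congˡ (zeroʳ y)) (+-identityʳ _)

  eval-+ᴾ : ∀ y u v → eval y (u +ᴾ v) ≈ eval y u + eval y v
  eval-+ᴾ y []      v       = sym (+-identityˡ _)
  eval-+ᴾ y (a ∷ u) []      = sym (+-identityʳ _)
  eval-+ᴾ y (a ∷ u) (b ∷ v) = begin
    (a ℕ.+ b) · 1# + y * eval y (u +ᴾ v)        ≈⟨ +-cong (×-homo-+ 1# a b) (*-congˡ (eval-+ᴾ y u v)) ⟩
    (a · 1# + b · 1#) + y * (eval y u + eval y v)
      ≈⟨ solve 5 (λ A B y U V → (A :+ B) :+ y :* (U :+ V) := (A :+ y :* U) :+ (B :+ y :* V))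
               refl (a · 1#) (b · 1#) y (eval y u) (eval y v) ⟩
    (a · 1# + y * eval y u) + (b · 1# + y * eval y v) ∎

  eval-·ᴾ : ∀ y c u → eval y (c ·ᴾ u) ≈ c · 1# * eval y u
  eval-·ᴾ y c []      = sym (zeroʳ _)
  eval-·ᴾ y c (a ∷ u) = begin
    (c ℕ.* a) · 1# + y * eval y (c ·ᴾ u)   ≈⟨ +-cong (×1-homo-* c a) (*-congˡ (eval-·ᴾ y c u)) ⟩
    c · 1# * a · 1# + y * (c · 1# * eval y u)
      ≈⟨ solve 4 (λ C A y U → C :* A :+ y :* (C :* U) := C :* (A :+ y :* U)) refl (c · 1#) (a · 1#) y (eval y u) ⟩
    c · 1# * (a · 1# + y * eval y u)       ∎

  eval-*ᴾ : ∀ y u v → eval y (u *ᴾ v) ≈ eval y u * eval y v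
  eval-*ᴾ y []      v = sym (zeroˡ _)
  eval-*ᴾ y (a ∷ u) v = begin
    eval y (a ·ᴾ v +ᴾ (0 ∷ u *ᴾ v))                  ≈⟨ eval-+ᴾ y (a ·ᴾ v) (0 ∷ u *ᴾ v) ⟩
    eval y (a ·ᴾ v) + (0# + y * eval y (u *ᴾ v))
      ≈⟨ +-cong (eval-·ᴾ y a v) (trans (+-identityˡ _) (*-congˡ (eval-*ᴾ y u v))) ⟩
    a · 1# * eval y v + y * (eval y u * eval y v)
      ≈⟨ solve 4 (λ A V y U → A :* V :+ y :* (U :* V) := (A :+ y :* U) :* V) refl (a · 1#) (eval y v) y (eval y u) ⟩
    (a · 1# + y * eval y u) * eval y v              ∎

  eval-∘ᴾ : ∀ y u g → eval y (u ∘ᴾ g) ≈ eval (eval y g) u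
  eval-∘ᴾ y []      g = refl
  eval-∘ᴾ y (a ∷ u) g = begin
    eval y ((a ∷ []) +ᴾ g *ᴾ (u ∘ᴾ g))        ≈⟨ eval-+ᴾ y (a ∷ []) (g *ᴾ (u ∘ᴾ g)) ⟩
    eval y (a ∷ []) + eval y (g *ᴾ (u ∘ᴾ g))  ≈⟨ +-cong (eval-constant y a) (eval-*ᴾ y g (u ∘ᴾ g)) ⟩
    a · 1# + eval y g * eval y (u ∘ᴾ g)       ≈⟨ +-congˡ (*-congˡ (eval-∘ᴾ y u g)) ⟩
    a · 1# + eval y g * eval (eval y g) u     ∎

  eval-Xᴾ^ : ∀ y n → eval y (Xᴾ^ n) ≈ y ^ n
  eval-Xᴾ^ y zero    = trans (eval-constant y 1) (+-identityʳ 1#)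
  eval-Xᴾ^ y (suc n) = trans (+-identityˡ _) (*-congˡ (eval-Xᴾ^ y n))

  eval-trim : ∀ y u → eval y (trim u) ≈ eval y u
  eval-trim y []      = refl
  eval-trim y (a ∷ u) = trans (eval-∷₀ a (trim u)) (+-congˡ (*-congˡ (eval-trim y u)))
    where
    eval-∷₀ : ∀ a u → eval y (a ∷₀ u) ≈ eval y (a ∷ u)
    eval-∷₀ zero    []      = sym (trans (+-identityˡ _) (zeroʳ y))
    eval-∷₀ zero    (_ ∷ _) = refl
    eval-∷₀ (suc a) u       = refl

  eval-++ : ∀ y u v → eval y (u ++ v) ≈ eval y u + y ^ length u * eval y v
  eval-++ y []      v = sym (trans (+-identityˡ _) (*-identityˡ _))
  eval-++ y (a ∷ u) v = begin
    a · 1# + y * eval y (u ++ v)                          ≈⟨ +-congˡ (*-congˡ (eval-++ y u v)) ⟩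
    a · 1# + y * (eval y u + y ^ length u * eval y v)
      ≈⟨ solve 5 (λ A y U P V → A :+ y :* (U :+ P :* V) := (A :+ y :* U) :+ (y :* P) :* V)
               refl (a · 1#) y (eval y u) (y ^ length u) (eval y v) ⟩
    (a · 1# + y * eval y u) + (y * y ^ length u) * eval y v ∎

  eval-take-drop : ∀ y k u → eval y u ≈ eval y (take k u) + y ^ k * eval y (drop k u)
  eval-take-drop y zero    u       = sym (trans (+-identityˡ _) (*-identityˡ _))
  eval-take-drop y (suc k) []      = sym (trans (+-identityˡ _) (zeroʳ _))
  eval-take-drop y (suc k) (a ∷ u) = begin
    a · 1# + y * eval y u                                       ≈⟨ +-congˡ (*-congˡ (eval-take-drop y k u)) ⟩
    a · 1# + y * (eval y (take k u) + y ^ k * eval y (drop k u))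
      ≈⟨ solve 5 (λ A y T P D → A :+ y :* (T :+ P :* D) := (A :+ y :* T) :+ (y :* P) :* D)
               refl (a · 1#) y (eval y (take k u)) (y ^ k) (eval y (drop k u)) ⟩
    (a · 1# + y * eval y (take k u)) + (y * y ^ k) * eval y (drop k u) ∎

  module _ {p} (char : IsCharacteristic p) where
    open Modular p {{p-nonZero char}}

    eval-reduce : ∀ y u → eval y (reduce u) ≈ eval y u
    eval-reduce y []      = refl
    eval-reduce y (a ∷ u) = +-cong (·1-% char a) (*-congˡ (eval-reduce y u))

    eval-negate : ∀ y u → eval y (negate u) ≈ - eval y u
    eval-negate y []      = sym -0#≈0#
      where open import Algebra.Properties.Ring ring using (-0#≈0#)
    eval-negate y (a ∷ u) = begin
      ((p ℕ.∸ 1) ℕ.* a) · 1# + y * eval y (negate u)  ≈⟨ +-cong ([p-1]*n·1≈-n·1 char a) (*-congˡ (eval-negate y u)) ⟩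
      - (a · 1#) + y * - eval y u                     ≈⟨ +-congˡ (-‿distribʳ-* y _) ⟨
      - (a · 1#) + - (y * eval y u)                   ≈⟨ -‿+-comm _ _ ⟩
      - (a · 1# + y * eval y u)                       ∎

    module _ {y k r} (y^k≈r : y ^ k ≈ eval y r) where

      eval-reduceBy : ∀ fuel u → eval y (reduceBy k r fuel u) ≈ eval y u
      eval-reduceBy zero       u = refl
      eval-reduceBy (suc fuel) u with length u ℕ.≤ᵇ k
      ... | true  = refl
      ... | false = begin
        eval y (reduceBy k r fuel (reduce (take k u +ᴾ r *ᴾ drop k u)))
          ≈⟨ eval-reduceBy fuel _ ⟩
        eval y (reduce (take k u +ᴾ r *ᴾ drop k u))
          ≈⟨ eval-reduce y (take k u +ᴾ r *ᴾ drop k u) ⟩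
        eval y (take k u +ᴾ r *ᴾ drop k u)
          ≈⟨ eval-+ᴾ y (take k u) (r *ᴾ drop k u) ⟩
        eval y (take k u) + eval y (r *ᴾ drop k u)
          ≈⟨ +-congˡ (trans (eval-*ᴾ y r (drop k u)) (*-congʳ (sym y^k≈r))) ⟩
        eval y (take k u) + y ^ k * eval y (drop k u)
          ≈⟨ eval-take-drop y k u ⟨
        eval y u ∎

      eval-normalForm : ∀ u → eval y (normalForm k r u) ≈ eval y u
      eval-normalForm u = trans (eval-trim y (reduce v)) (trans (eval-reduce y v) (eval-reduceBy (length u) u))
        where v = reduceBy k r (length u) u

    eval-normalForm₀ : ∀ y u → eval y (normalForm₀ u) ≈ eval y u
    eval-normalForm₀ y u = trans (eval-trim y (reduce u)) (eval-reduce y u)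

    root⇒power≈ : ∀ {y} f → eval y (monic f) ≈ 0# → y ^ length f ≈ eval y (negate f)
    root⇒power≈ {y} f root = begin
      y ^ length f            ≈⟨ +-inverseʳ-unique _ _ sum≈0 ⟩
      - eval y f              ≈⟨ eval-negate y f ⟨
      eval y (negate f)       ∎
      where
      sum≈0 : eval y f + y ^ length f ≈ 0#
      sum≈0 = begin
        eval y f + y ^ length f                     ≈⟨ +-congˡ (*-identityʳ _) ⟨
        eval y f + y ^ length f * 1#                ≈⟨ +-congˡ (*-congˡ (trans (eval-constant y 1) (+-identityʳ 1#))) ⟨
        eval y f + y ^ length f * eval y (1 ∷ [])   ≈⟨ eval-++ y f (1 ∷ []) ⟨
        eval y (monic f)                            ≈⟨ root ⟩
        0#                                          ∎

-- Rotations and the corner criterion for reducibility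

module _ {a} {A : Set a} where

  -- Defs' rotate, for lists of any type: the candidates are rotated as lists of polynomials.
  rotation : ℕ → List A → List A
  rotation zero    xs       = xs
  rotation (suc k) []       = []
  rotation (suc k) (x ∷ xs) = rotation k (xs ++ x ∷ [])

  rotation-[] : ∀ k → rotation k [] ≡ []
  rotation-[] zero    = ≡.refl
  rotation-[] (suc k) = ≡.refl

  rotation-+ : ∀ m n xs → rotation (m ℕ.+ n) xs ≡ rotation n (rotation m xs)
  rotation-+ zero    n xs       = ≡.refl
  rotation-+ (suc m) n []       = ≡.trans (rotation-[] (suc m ℕ.+ n)) (≡.sym (rotation-[] n))
  rotation-+ (suc m) n (x ∷ xs) = rotation-+ m n (xs ++ x ∷ [])

  rotation-periodic : ∀ d {xs} → rotation d xs ≡ xs → ∀ m → rotation (m ℕ.* d) xs ≡ xs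
  rotation-periodic d period zero    = ≡.refl
  rotation-periodic d {xs} period (suc m) =
    ≡.trans (rotation-+ d (m ℕ.* d) xs) (≡.trans (≡.cong (rotation (m ℕ.* d)) period) (rotation-periodic d period m))

  rotation-% : ∀ d .{{_ : NonZero d}} {xs} → rotation d xs ≡ xs → ∀ k → rotation k xs ≡ rotation (k % d) xs
  rotation-% d {xs} period k = begin
    rotation k xs
      ≡⟨ ≡.cong (λ n → rotation n xs) (≡.trans (m≡m%n+[m/n]*n k d) (ℕP.+-comm (k % d) _)) ⟩
    rotation ((k / d) ℕ.* d ℕ.+ k % d) xs        ≡⟨ rotation-+ ((k / d) ℕ.* d) (k % d) xs ⟩
    rotation (k % d) (rotation ((k / d) ℕ.* d) xs) ≡⟨ ≡.cong (rotation (k % d)) (rotation-periodic d period (k / d)) ⟩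
    rotation (k % d) xs                          ∎
    where open ≡.≡-Reasoning

  rotation-++ : ∀ xs ys → rotation (length xs) (xs ++ ys) ≡ ys ++ xs
  rotation-++ []       ys = ≡.sym (ListP.++-identityʳ ys)
  rotation-++ (x ∷ xs) ys = begin
    rotation (length xs) ((xs ++ ys) ++ x ∷ [])  ≡⟨ ≡.cong (rotation (length xs)) (ListP.++-assoc xs ys (x ∷ [])) ⟩
    rotation (length xs) (xs ++ ys ++ x ∷ [])    ≡⟨ rotation-++ xs (ys ++ x ∷ []) ⟩
    (ys ++ x ∷ []) ++ xs                         ≡⟨ ListP.++-assoc ys (x ∷ []) xs ⟩
    ys ++ x ∷ xs                                 ∎
    where open ≡.≡-Reasoning

  concat-replicate-++ : ∀ n (t : List A) → concat (replicate n t) ++ t ≡ t ++ concat (replicate n t)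
  concat-replicate-++ zero    t = ≡.sym (ListP.++-identityʳ t)
  concat-replicate-++ (suc n) t = ≡.trans (ListP.++-assoc t _ t) (≡.cong (t ++_) (concat-replicate-++ n t))

  rotation-concat-replicate : ∀ n (t : List A) → rotation (length t) (concat (replicate n t)) ≡ concat (replicate n t)
  rotation-concat-replicate zero    t = rotation-[] (length t)
  rotation-concat-replicate (suc n) t = ≡.trans (rotation-++ t _) (concat-replicate-++ n t)

  reverse-concat-replicate : ∀ n (t : List A) → reverse (concat (replicate n t)) ≡ concat (replicate n (reverse t))
  reverse-concat-replicate zero    t = ≡.refl
  reverse-concat-replicate (suc n) t = begin
    reverse (t ++ concat (replicate n t))                ≡⟨ ListP.reverse-++ t _ ⟩
    reverse (concat (replicate n t)) ++ reverse t        ≡⟨ ≡.cong (_++ reverse t) (reverse-concat-replicate n t) ⟩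
    concat (replicate n (reverse t)) ++ reverse t        ≡⟨ concat-replicate-++ n (reverse t) ⟩
    reverse t ++ concat (replicate n (reverse t))        ∎
    where open ≡.≡-Reasoning

rotation-map : ∀ {a b} {A : Set a} {B : Set b} (f : A → B) k xs → rotation k (map f xs) ≡ map f (rotation k xs)
rotation-map f zero    xs       = ≡.refl
rotation-map f (suc k) []       = ≡.refl
rotation-map f (suc k) (x ∷ xs) =
  ≡.trans (≡.cong (rotation k) (≡.sym (ListP.map-++ f xs (x ∷ [])))) (rotation-map f k (xs ++ x ∷ []))

module SignCorner {c ℓ} (K : CommutativeRing c ℓ) where
  open CommutativeRing K
  open import Algebra.Properties.Ring ring using (-‿injective; -‿involutive; -‿distribʳ-*)
  open import Relation.Binary.Reasoning.Setoid setoid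

  IsSign : Carrier → Set ℓ
  IsSign x = x ≈ 1# ⊎ x ≈ - 1#

  IsSign-resp : ∀ {x y} → x ≈ y → IsSign x → IsSign y
  IsSign-resp x≈y = Sum.map (trans (sym x≈y)) (trans (sym x≈y))

  corner : Mat K → Carrier
  corner = Mat.m11

  SignCornerSplit : List Carrier → Set (c ⊔ ℓ)
  SignCornerSplit cs = ∃[ k ] ∃[ P ] ∃[ w ]
    ((_≋_ K (P ++ w) (rotation k cs) ⊎ _≋_ K (P ++ w) (rotation k (reverse cs)))
     × 3 ≤ length P × 1 ≤ length w × IsSign (corner (Mn K w)))

  rotate≡rotation : ∀ k xs → rotate K k xs ≡ rotation k xs
  rotate≡rotation zero    xs       = ≡.refl
  rotate≡rotation (suc k) []       = ≡.refl
  rotate≡rotation (suc k) (x ∷ xs) = rotate≡rotation k (xs ++ x ∷ [])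

  init-++-last : ∀ y ys → y ∷ ys ≡ init K (y ∷ ys) ++ last? K y ys ∷ []
  init-++-last y []       = ≡.refl
  init-++-last y (z ∷ zs) = ≡.cong (y ∷_) (init-++-last z zs)

  length-init : ∀ y ys → length (init K (y ∷ ys)) ≡ length ys
  length-init y []       = ≡.refl
  length-init y (z ∷ zs) = ≡.cong suc (length-init z zs)

  -- Row 2 of M(w, z) is row 1 of M(w), since row 2 of each factor (a -1 / 1 0) is (1 0).
  Mn-snoc-row₂ : ∀ w z → Mat.m21 (Mn K (w ++ z ∷ [])) ≈ Mat.m11 (Mn K w)
                       × Mat.m22 (Mn K (w ++ z ∷ [])) ≈ Mat.m12 (Mn K w)
  Mn-snoc-row₂ []      z = trans (+-cong (zeroˡ z) (*-identityˡ 1#)) (+-identityˡ 1#)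
                         , trans (+-cong (zeroˡ _) (zeroʳ 1#)) (+-identityˡ 0#)
  Mn-snoc-row₂ (x ∷ w) z with Mn K (w ++ z ∷ []) | Mn K w | Mn-snoc-row₂ w z
  ... | mat _ _ _ _ | mat _ _ _ _ | e₁ , e₂ = +-cong (*-congʳ e₁) (*-congʳ e₂) , +-cong (*-congʳ e₁) (*-congʳ e₂)

  m22-⊗-Ma : ∀ M b → Mat.m22 (_⊗_ K M (Ma K b)) ≈ - Mat.m21 M
  m22-⊗-Ma (mat _ _ m₃ m₄) b = begin
    m₃ * - 1# + m₄ * 0#   ≈⟨ +-cong (sym (-‿distribʳ-* m₃ 1#)) (zeroʳ m₄) ⟩
    - (m₃ * 1#) + 0#      ≈⟨ +-identityʳ _ ⟩
    - (m₃ * 1#)           ≈⟨ -‿cong (*-identityʳ m₃) ⟩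
    - m₃                  ∎

  quiddity⇒sign-corner : ∀ b w z → IsQuiddity K (b ∷ w ++ z ∷ []) → IsSign (corner (Mn K w))
  quiddity⇒sign-corner b w z = corner-sign
    where
    -m₁₁≈m₂₂ : - corner (Mn K w) ≈ Mat.m22 (Mn K (b ∷ w ++ z ∷ []))
    -m₁₁≈m₂₂ = sym (trans (m22-⊗-Ma (Mn K (w ++ z ∷ [])) b) (-‿cong (proj₁ (Mn-snoc-row₂ w z))))
    corner-sign : IsQuiddity K (b ∷ w ++ z ∷ []) → IsSign (corner (Mn K w))
    corner-sign (inj₁ (_ , _ , _ , m₂₂≈1))  = inj₂ (trans (sym (-‿involutive _)) (-‿cong (trans -m₁₁≈m₂₂ m₂₂≈1)))
    corner-sign (inj₂ (_ , _ , _ , m₂₂≈-1)) = inj₁ (-‿injective (trans -m₁₁≈m₂₂ m₂₂≈-1))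

  reducible⇒sign-corner-split : ∀ cs → IsReducible K cs → SignCornerSplit cs
  reducible⇒sign-corner-split cs
    (_ , b ∷ y ∷ y′ ∷ ys , a ∷ a′ ∷ as , quiddity , s≤s (s≤s (s≤s _)) , s≤s (s≤s 1≤|as|) , k , rel) =
    k , P , w , rotated , |P|≥3 , |w|≥1 ,
    quiddity⇒sign-corner b w z (≡.subst (λ t → IsQuiddity K (b ∷ t)) (init-++-last y (y′ ∷ ys)) quiddity)
    where
    w = init K (y ∷ y′ ∷ ys)
    z = last? K y (y′ ∷ ys)
    P = (a + last? K b (y ∷ y′ ∷ ys)) ∷ (init K (a′ ∷ as) ++ last? K a (a′ ∷ as) + b ∷ [])
    P++w≡ : P ++ w ≡ _⊕_ K (a ∷ a′ ∷ as) (b ∷ y ∷ y′ ∷ ys)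
    P++w≡ = ≡.cong (_ ∷_) (ListP.++-assoc (init K (a′ ∷ as)) _ w)
    rotated : _≋_ K (P ++ w) (rotation k cs) ⊎ _≋_ K (P ++ w) (rotation k (reverse cs))
    rotated = Sum.map (≡.subst₂ (_≋_ K) (≡.sym P++w≡) (rotate≡rotation k cs))
                      (≡.subst₂ (_≋_ K) (≡.sym P++w≡) (rotate≡rotation k (reverse cs))) rel
    |P|≥3 : 3 ≤ length P
    |P|≥3 = ≡.subst (3 ≤_) (≡.sym |P|≡) (s≤s (s≤s 1≤|as|))
      where
      |P|≡ : length P ≡ suc (suc (length as))
      |P|≡ = ≡.cong suc (≡.trans (ListP.length-++ (init K (a′ ∷ as)))
                        (≡.trans (≡.cong (ℕ._+ 1) (length-init a′ as)) (ℕP.+-comm (length as) 1)))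
    |w|≥1 : 1 ≤ length w
    |w|≥1 = ≡.subst (1 ≤_) (≡.sym (length-init y (y′ ∷ ys))) (s≤s z≤n)

-- Arithmetic in F_p[X]/(m) and its evaluation at a root of m

infix 4 _≟ᴾ_

_≟ᴾ_ : DecidableEquality Poly
_≟ᴾ_ = ListP.≡-dec ℕP._≟_

module QuotientArithmetic (p : ℕ) .{{_ : NonZero p}} (k : ℕ) (r : Poly) where
  open Modular p

  infixl 6 _+ʳ_
  infixl 7 _*ʳ_
  infixr 8 _^ʳ_
  infix 4 _≐_ _≐?_

  _+ʳ_ _*ʳ_ : Poly → Poly → Poly
  u +ʳ v = normalForm k r (u +ᴾ v)
  u *ʳ v = normalForm k r (u *ᴾ v)

  0ʳ 1ʳ -1ʳ : Poly
  0ʳ  = []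
  1ʳ  = 1 ∷ []
  -1ʳ = normalForm k r ((p ℕ.∸ 1) ∷ [])

  _^ʳ_ : Poly → ℕ → Poly
  u ^ʳ zero  = 1ʳ
  u ^ʳ suc n = u *ʳ u ^ʳ n

  record Matʳ : Set where
    constructor matʳ
    field
      m11 m12 m21 m22 : Poly

  _⊗ʳ_ : Matʳ → Matʳ → Matʳ
  matʳ a b c d ⊗ʳ matʳ e f g h =
    matʳ (a *ʳ e +ʳ b *ʳ g) (a *ʳ f +ʳ b *ʳ h) (c *ʳ e +ʳ d *ʳ g) (c *ʳ f +ʳ d *ʳ h)

  Idʳ -Idʳ : Matʳ
  Idʳ  = matʳ 1ʳ 0ʳ 0ʳ 1ʳ
  -Idʳ = matʳ -1ʳ 0ʳ 0ʳ -1ʳ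

  Maʳ : Poly → Matʳ
  Maʳ x = matʳ x -1ʳ 1ʳ 0ʳ

  Mnʳ : List Poly → Matʳ
  Mnʳ []       = Idʳ
  Mnʳ (x ∷ xs) = Mnʳ xs ⊗ʳ Maʳ x

  _≐_ : Matʳ → Matʳ → Set
  matʳ a b c d ≐ matʳ e f g h = a ≡ e × b ≡ f × c ≡ g × d ≡ h

  _≐?_ : ∀ M N → Dec (M ≐ N)
  matʳ a b c d ≐? matʳ e f g h = (a ≟ᴾ e) ×-dec (b ≟ᴾ f) ×-dec (c ≟ᴾ g) ×-dec (d ≟ᴾ h)

  isQuiddityʳ : List Poly → Bool
  isQuiddityʳ L = ⌊ (Mnʳ L ≐? Idʳ) ⊎-dec (Mnʳ L ≐? -Idʳ) ⌋

  -- Exponent p ^ k ∸ 2 is the inverse power in a field with p ^ k elements; any exponent would be sound.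
  isUnitʳ : Poly → Bool
  isUnitʳ u = ⌊ u *ʳ u ^ʳ (p ℕ.^ k ℕ.∸ 2) ≟ᴾ 1ʳ ⌋

  notSignʳ : Poly → Bool
  notSignʳ z = isUnitʳ (z +ʳ -1ʳ) ∧ isUnitʳ (z +ʳ 1ʳ)

  suffixProducts : ℕ → List Poly → Matʳ × Bool
  suffixProducts n []      = Idʳ , true
  suffixProducts n (x ∷ w) with suffixProducts n w
  ... | M , ok = M ⊗ʳ Maʳ x ,
                 ok ∧ (if suc (length w) ℕ.+ 3 ℕ.≤ᵇ n then notSignʳ (Matʳ.m11 (M ⊗ʳ Maʳ x)) else true)

  noSignSuffix : List Poly → Bool
  noSignSuffix R = proj₂ (suffixProducts (length R) R)

  noSignCornerSplitʳ : ℕ → List Poly → Bool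
  noSignCornerSplitʳ d L =
    ⌊ ℕP.allUpTo? (λ i → T? (noSignSuffix (rotation i L) ∧ noSignSuffix (rotation i (reverse L)))) d ⌋

module Matrices {c ℓ} (K : CommutativeRing c ℓ) where
  open CommutativeRing K

  ≈M-sym : ∀ {M N} → _≈M_ K M N → _≈M_ K N M
  ≈M-sym {mat _ _ _ _} {mat _ _ _ _} (e₁ , e₂ , e₃ , e₄) = sym e₁ , sym e₂ , sym e₃ , sym e₄

  ≈M-trans : ∀ {M N O} → _≈M_ K M N → _≈M_ K N O → _≈M_ K M O
  ≈M-trans {mat _ _ _ _} {mat _ _ _ _} {mat _ _ _ _} (e₁ , e₂ , e₃ , e₄) (f₁ , f₂ , f₃ , f₄) =
    trans e₁ f₁ , trans e₂ f₂ , trans e₃ f₃ , trans e₄ f₄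

  ⊗-cong : ∀ {M M′ N N′} → _≈M_ K M M′ → _≈M_ K N N′ → _≈M_ K (_⊗_ K M N) (_⊗_ K M′ N′)
  ⊗-cong {mat _ _ _ _} {mat _ _ _ _} {mat _ _ _ _} {mat _ _ _ _} (e₁ , e₂ , e₃ , e₄) (f₁ , f₂ , f₃ , f₄) =
    +-cong (*-cong e₁ f₁) (*-cong e₂ f₃) , +-cong (*-cong e₁ f₂) (*-cong e₂ f₄) ,
    +-cong (*-cong e₃ f₁) (*-cong e₄ f₃) , +-cong (*-cong e₃ f₂) (*-cong e₄ f₄)

  Mn-cong : ∀ {xs ys} → _≋_ K xs ys → _≈M_ K (Mn K xs) (Mn K ys)
  Mn-cong []         = refl , refl , refl , refl
  Mn-cong (x≈y ∷ xs≋ys) = ⊗-cong (Mn-cong xs≋ys) (x≈y , refl , refl , refl)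

++-map-split : ∀ {a b c r} {A : Set a} {B : Set b} {C : Set c} {R : A → C → Set r} (f : B → C) P w L →
               Pointwise R (P ++ w) (map f L) →
               ∃[ L₁ ] ∃[ L₂ ] (L ≡ L₁ ++ L₂ × length L₁ ≡ length P × Pointwise R w (map f L₂))
++-map-split f []      w L       P++w≈ = [] , L , ≡.refl , ≡.refl , P++w≈
++-map-split f (_ ∷ P) w (y ∷ L) (_ ∷ P++w≈) with ++-map-split f P w L P++w≈
... | L₁ , L₂ , L≡ , |L₁|≡ , w≈ = y ∷ L₁ , L₂ , ≡.cong (y ∷_) L≡ , ≡.cong suc |L₁|≡ , w≈

module QuotientEvaluation {c ℓ} (K : CommutativeRing c ℓ) (isField : IsField K) where
  open CommutativeRing K
  open FieldProperties K isField using (1≉0)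
  open Characteristic K
  open Evaluation K
  open SignCorner K
  open Matrices K
  open import Algebra.Properties.Semiring.Exp semiring using (_^_)
  open import Algebra.Properties.Ring ring using (-0#≈0#)
  open import Relation.Binary.Reasoning.Setoid setoid

  module _ {p} (char : IsCharacteristic p) {k r α} (α^k≈r : α ^ k ≈ eval α r) where
    open QuotientArithmetic p {{p-nonZero char}} k r

    ψ : Poly → Carrier
    ψ = eval α

    ψ-+ʳ : ∀ u v → ψ (u +ʳ v) ≈ ψ u + ψ v
    ψ-+ʳ u v = trans (eval-normalForm char α^k≈r (u +ᴾ v)) (eval-+ᴾ α u v)

    ψ-*ʳ : ∀ u v → ψ (u *ʳ v) ≈ ψ u * ψ v
    ψ-*ʳ u v = trans (eval-normalForm char α^k≈r (u *ᴾ v)) (eval-*ᴾ α u v)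

    ψ-1ʳ : ψ 1ʳ ≈ 1#
    ψ-1ʳ = trans (eval-constant α 1) (+-identityʳ 1#)

    ψ-[-1ʳ] : ψ -1ʳ ≈ - 1#
    ψ-[-1ʳ] = trans (eval-normalForm char {k = k} {r} α^k≈r ((p ℕ.∸ 1) ∷ []))
                    (trans (eval-constant α (p ℕ.∸ 1)) ([p-1]·1≈-1 char))

    ψᴹ : Matʳ → Mat K
    ψᴹ (matʳ a b c d) = mat (ψ a) (ψ b) (ψ c) (ψ d)

    ψᴹ-⊗ʳ : ∀ M N → _≈M_ K (ψᴹ (M ⊗ʳ N)) (_⊗_ K (ψᴹ M) (ψᴹ N))
    ψᴹ-⊗ʳ (matʳ a b c d) (matʳ e f g h) = entry a e b g , entry a f b h , entry c e d g , entry c f d h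
      where
      entry : ∀ x y z w → ψ (x *ʳ y +ʳ z *ʳ w) ≈ ψ x * ψ y + ψ z * ψ w
      entry x y z w = trans (ψ-+ʳ (x *ʳ y) (z *ʳ w)) (+-cong (ψ-*ʳ x y) (ψ-*ʳ z w))

    ψᴹ-≐ : ∀ {M N} → M ≐ N → _≈M_ K (ψᴹ M) (ψᴹ N)
    ψᴹ-≐ {matʳ _ _ _ _} {matʳ _ _ _ _} (≡.refl , ≡.refl , ≡.refl , ≡.refl) = refl , refl , refl , refl

    Mn-map-ψ : ∀ L → _≈M_ K (Mn K (map ψ L)) (ψᴹ (Mnʳ L))
    Mn-map-ψ []      = sym ψ-1ʳ , refl , refl , sym ψ-1ʳ
    Mn-map-ψ (x ∷ L) = ≈M-trans (⊗-cong (Mn-map-ψ L) (refl , sym ψ-[-1ʳ] , sym ψ-1ʳ , refl))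
                                (≈M-sym (ψᴹ-⊗ʳ (Mnʳ L) (Maʳ x)))

    isUnit-sound : ∀ u → T (isUnitʳ u) → ¬ ψ u ≈ 0#
    isUnit-sound u unit ψu≈0 = 1≉0 (begin
      1#                ≈⟨ ψ-1ʳ ⟨
      ψ 1ʳ              ≡⟨ ≡.cong ψ (≡.sym (toWitness unit)) ⟩
      ψ (u *ʳ v)        ≈⟨ ψ-*ʳ u v ⟩
      ψ u * ψ v         ≈⟨ *-congʳ ψu≈0 ⟩
      0# * ψ v          ≈⟨ zeroˡ (ψ v) ⟩
      0#                ∎)
      where v = u ^ʳ (p ℕ.^ k ℕ.∸ 2)

    notSign-sound : ∀ z → T (notSignʳ z) → ¬ IsSign (ψ z)
    notSign-sound z ok (inj₁ ψz≈1) = isUnit-sound (z +ʳ -1ʳ) (proj₁ (Equivalence.to (T-∧ {isUnitʳ (z +ʳ -1ʳ)}) ok))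
      (trans (ψ-+ʳ z -1ʳ) (trans (+-cong ψz≈1 ψ-[-1ʳ]) (-‿inverseʳ 1#)))
    notSign-sound z ok (inj₂ ψz≈-1) = isUnit-sound (z +ʳ 1ʳ) (proj₂ (Equivalence.to (T-∧ {isUnitʳ (z +ʳ -1ʳ)}) ok))
      (trans (ψ-+ʳ z 1ʳ) (trans (+-cong ψz≈-1 ψ-1ʳ) (-‿inverseˡ 1#)))

    suffixProducts-matrix : ∀ n w → proj₁ (suffixProducts n w) ≡ Mnʳ w
    suffixProducts-matrix n []      = ≡.refl
    suffixProducts-matrix n (x ∷ w) with suffixProducts n w | suffixProducts-matrix n w
    ... | _ , _ | ≡.refl = ≡.refl

    suffixProducts-sound : ∀ n R₁ R₂ → T (proj₂ (suffixProducts n (R₁ ++ R₂))) →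
                           1 ≤ length R₂ → length R₂ ℕ.+ 3 ≤ n → T (notSignʳ (Matʳ.m11 (Mnʳ R₂)))
    suffixProducts-sound n [] (x ∷ w) ok _ short with suffixProducts n w | suffixProducts-matrix n w
    ... | _ , okʷ | ≡.refl with suc (length w) ℕ.+ 3 ℕ.≤ᵇ n | ℕP.≤⇒≤ᵇ short
    ...   | true | _ = proj₂ (Equivalence.to (T-∧ {okʷ}) ok)
    suffixProducts-sound n (y ∷ R₁) R₂ ok |R₂|≥1 short with suffixProducts n (R₁ ++ R₂) | suffixProducts-sound n R₁ R₂
    ... | _ , okʳ | ih = ih (proj₁ (Equivalence.to (T-∧ {okʳ}) ok)) |R₂|≥1 short

    noSignSuffix-sound : ∀ R {P w} → T (noSignSuffix R) → _≋_ K (P ++ w) (map ψ R) →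
                         3 ≤ length P → 1 ≤ length w → ¬ IsSign (corner (Mn K w))
    noSignSuffix-sound R {P} {w} ok P++w≋ |P|≥3 |w|≥1 sign with ++-map-split ψ P w R P++w≋
    ... | R₁ , R₂ , ≡.refl , |R₁|≡|P| , w≋ =
      notSign-sound (Matʳ.m11 (Mnʳ R₂)) (suffixProducts-sound _ R₁ R₂ ok |R₂|≥1 short)
        (IsSign-resp (trans (proj₁ (Mn-cong w≋)) (proj₁ (Mn-map-ψ R₂))) sign)
      where
      |w|≡|R₂| : length w ≡ length R₂
      |w|≡|R₂| = ≡.trans (Pointwise-length w≋) (ListP.length-map ψ R₂)
      |R₂|≥1 : 1 ≤ length R₂
      |R₂|≥1 = ≡.subst (1 ≤_) |w|≡|R₂| |w|≥1
      short : length R₂ ℕ.+ 3 ≤ length (R₁ ++ R₂)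
      short = ≡.subst (length R₂ ℕ.+ 3 ≤_) (≡.sym (ListP.length-++ R₁))
                (≡.subst (ℕ._≤ length R₁ ℕ.+ length R₂) (ℕP.+-comm 3 (length R₂))
                  (ℕP.+-monoˡ-≤ (length R₂) (≡.subst (3 ≤_) (≡.sym |R₁|≡|P|) |P|≥3)))

    irreducible-quiddity : ∀ L d .{{_ : NonZero d}} → rotation d L ≡ L → rotation d (reverse L) ≡ reverse L →
                           3 ≤ length L → T (isQuiddityʳ L) → T (noSignCornerSplitʳ d L) →
                           IsIrreducibleQuiddity K (map ψ L)
    irreducible-quiddity L d period period′ |L|≥3 quid noSplit = |map|≥3 , quiddity (toWitness quid) , irreducible
      where
      |map|≥3 : 3 ≤ length (map ψ L)
      |map|≥3 = ≡.subst (3 ≤_) (≡.sym (ListP.length-map ψ L)) |L|≥3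
      quiddity : (Mnʳ L ≐ Idʳ) ⊎ (Mnʳ L ≐ -Idʳ) → IsQuiddity K (map ψ L)
      quiddity (inj₁ ≐Id)  = inj₁ (≈M-trans (Mn-map-ψ L) (≈M-trans (ψᴹ-≐ ≐Id) (ψ-1ʳ , refl , refl , ψ-1ʳ)))
      quiddity (inj₂ ≐-Id) =
        inj₂ (≈M-trans (Mn-map-ψ L) (≈M-trans (ψᴹ-≐ ≐-Id) (ψ-[-1ʳ] , sym -0#≈0# , sym -0#≈0# , ψ-[-1ʳ])))
      checked : ∀ i → T (noSignSuffix (rotation i L)) × T (noSignSuffix (rotation i (reverse L)))
      checked i = ≡.subst₂ (λ R R′ → T (noSignSuffix R) × T (noSignSuffix R′))
                    (≡.sym (rotation-% d period i)) (≡.sym (rotation-% d period′ i))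
                    (Equivalence.to (T-∧ {noSignSuffix (rotation (i % d) L)}) (toWitness noSplit (m%n<n i d)))
      irreducible : ¬ IsReducible K (map ψ L)
      irreducible red with reducible⇒sign-corner-split (map ψ L) red
      ... | i , P , w , inj₁ P++w≋ , |P|≥3 , |w|≥1 , sign =
        noSignSuffix-sound (rotation i L) {P} {w} (proj₁ (checked i))
          (≡.subst (_≋_ K (P ++ w)) (rotation-map ψ i L) P++w≋) |P|≥3 |w|≥1 sign
      ... | i , P , w , inj₂ P++w≋ , |P|≥3 , |w|≥1 , sign =
        noSignSuffix-sound (rotation i (reverse L)) {P} {w} (proj₂ (checked i))
          (≡.subst (_≋_ K (P ++ w))
            (≡.trans (≡.cong (rotation i) (≡.sym (ListP.reverse-map ψ L))) (rotation-map ψ i (reverse L))) P++w≋)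
          |P|≥3 |w|≥1 sign

-- A root of m from a factorisation of X ^ q - X

data FactorKind : Set where
  linear      : FactorKind
  mapsTo      : Poly → FactorKind
  cyclotomic₃ : FactorKind

-- Monic factors of X ^ q - X, given by their lower coefficients, each tagged with where its roots go.
Factorisation : Set
Factorisation = List (Poly × FactorKind)

module FactorisationCheck (p : ℕ) .{{_ : NonZero p}} where
  open Modular p

  X^q-X : ℕ → Poly
  X^q-X q = (0 ∷ (p ℕ.∸ 1) ∷ []) +ᴾ Xᴾ^ q

  product : Factorisation → Poly
  product []             = 1 ∷ []
  product ((f , _) ∷ fs) = normalForm₀ (monic f *ᴾ product fs)

  -- mapsTo g certifies m (g (X)) ≡ 0 modulo the factor, so g maps its roots to roots of m.
  kindOK : Bool → Poly → Poly × FactorKind → Bool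
  kindOK allow₃ m (f      , mapsTo g)    = ⌊ normalForm (length f) (negate f) (monic m ∘ᴾ g) ≟ᴾ [] ⌋
  kindOK allow₃ m (f      , cyclotomic₃) = allow₃ ∧ ⌊ f ≟ᴾ 1 ∷ 1 ∷ [] ⌋
  kindOK allow₃ m (_ ∷ [] , linear)      = true
  kindOK allow₃ m (_      , linear)      = false

  certifies : Bool → ℕ → Poly → Factorisation → Bool
  certifies allow₃ q m fs = ⌊ normalForm₀ (product fs) ≟ᴾ normalForm₀ (X^q-X q) ⌋ ∧ all (kindOK allow₃ m) fs

module Roots {c ℓ} (K : CommutativeRing c ℓ) (isField : IsField K) {q} (card : HasCardinality K q) where
  open CommutativeRing K
  open FieldProperties K isField
  open Characteristic K
  open FiniteField K isField card
  open Evaluation K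
  open import Algebra.Properties.Semiring.Mult semiring using () renaming (_×_ to _·_)
  open import Algebra.Properties.Ring ring using (x∙y⁻¹≈ε⇒x≈y; +-inverseʳ-unique)
  open import Algebra.Solver.Ring.NaturalCoefficients.Default commutativeSemiring
    using (solve; _:=_; _:+_; _:*_; con)
  open import Relation.Binary.Reasoning.Setoid setoid

  HasRoot : Poly → Set (c ⊔ ℓ)
  HasRoot m = ∃[ α ] eval α (monic m) ≈ 0#

  X-has-root : HasRoot (0 ∷ [])
  X-has-root = 0# , trans (+-identityˡ _) (zeroˡ _)

  eval-X²+X+1 : ∀ x → eval x (monic (1 ∷ 1 ∷ [])) ≈ 1# + x * (1# + x)
  eval-X²+X+1 x = +-cong (+-identityʳ 1#) (*-congˡ (+-cong (+-identityʳ 1#)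
    (trans (*-congˡ (trans (eval-constant x 1) (+-identityʳ 1#))) (*-identityʳ x))))

  -- Two roots of X² + X + 1 either agree or sum to -1: with y = x - β, x² + x + 1 = y (y + 2β + 1) + β² + β + 1.
  X²+X+1-roots : ∀ {β x} → 1# + β * (1# + β) ≈ 0# → 1# + x * (1# + x) ≈ 0# → x ≈ β ⊎ x + (β + 1#) ≈ 0#
  X²+X+1-roots {β} {x} β-root x-root =
    Sum.map (x∙y⁻¹≈ε⇒x≈y x β) (trans (sym (+-congʳ y+β≈x))) (*-integral y[y+2β+1]≈0)
    where
    y = x - β
    y+β≈x : y + β ≈ x
    y+β≈x = trans (+-assoc x (- β) β) (trans (+-congˡ (-‿inverseˡ β)) (+-identityʳ x))
    y[y+2β+1]≈0 : y * (y + β + (β + 1#)) ≈ 0#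
    y[y+2β+1]≈0 = begin
      y * (y + β + (β + 1#))                                   ≈⟨ +-identityʳ _ ⟨
      y * (y + β + (β + 1#)) + 0#                              ≈⟨ +-congˡ β-root ⟨
      y * (y + β + (β + 1#)) + (1# + β * (1# + β))
        ≈⟨ solve 2 (λ y β → y :* (y :+ β :+ (β :+ con 1)) :+ (con 1 :+ β :* (con 1 :+ β))
                           := con 1 :+ (y :+ β) :* (con 1 :+ (y :+ β))) refl y β ⟩
      1# + (y + β) * (1# + (y + β))                            ≈⟨ +-congˡ (*-cong y+β≈x (+-congˡ y+β≈x)) ⟩
      1# + x * (1# + x)                                        ≈⟨ x-root ⟩
      0#                                                       ∎

  module _ {p} (char : IsCharacteristic p) where
    open FactorisationCheck p {{p-nonZero char}}
    open Modular p {{p-nonZero char}}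
    open BaseDigits p {{p-nonZero char}}
    private instance
      p≢0 : NonZero p
      p≢0 = p-nonZero char

    eval-X^q-X : ∀ x → eval x (X^q-X q) ≈ 0#
    eval-X^q-X x = begin
      eval x ((0 ∷ (p ℕ.∸ 1) ∷ []) +ᴾ Xᴾ^ q)                ≈⟨ eval-+ᴾ x (0 ∷ (p ℕ.∸ 1) ∷ []) (Xᴾ^ q) ⟩
      0# + x * eval x ((p ℕ.∸ 1) ∷ []) + eval x (Xᴾ^ q)
        ≈⟨ +-cong (trans (+-identityˡ _) (*-congˡ -1≈)) (eval-Xᴾ^ x q) ⟩
      x * - 1# + x ^ q
        ≈⟨ +-cong (trans (sym (-‿distribʳ-* x 1#)) (-‿cong (*-identityʳ x))) (fermat x) ⟩
      - x + x                                               ≈⟨ -‿inverseˡ x ⟩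
      0#                                                    ∎
      where
      open import Algebra.Properties.Semiring.Exp semiring using (_^_)
      open import Algebra.Properties.Ring ring using (-‿distribʳ-*)
      -1≈ : eval x ((p ℕ.∸ 1) ∷ []) ≈ - 1#
      -1≈ = trans (eval-constant x (p ℕ.∸ 1)) ([p-1]·1≈-1 char)

    product-root : ∀ x fs → eval x (product fs) ≈ 0# → Any (λ e → eval x (monic (proj₁ e)) ≈ 0#) fs
    product-root x []             root = ⊥-elim (1≉0 (trans (sym (trans (eval-constant x 1) (+-identityʳ 1#))) root))
    product-root x ((f , _) ∷ fs) root
      with *-integral (trans (sym (trans (eval-normalForm₀ char x (monic f *ᴾ product fs))
                                         (eval-*ᴾ x (monic f) (product fs)))) root)
    ... | inj₁ f-root    = here f-root
    ... | inj₂ rest-root = there (product-root x fs rest-root)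

    OutsidePrimeField : Carrier → Set ℓ
    OutsidePrimeField x = ∀ (t : Fin p) → ¬ toℕ t · 1# ≈ x

    factor-root : ∀ {x} → OutsidePrimeField x → ∀ allow₃ m e → T (kindOK allow₃ m e) →
                  eval x (monic (proj₁ e)) ≈ 0# → HasRoot m ⊎ (T allow₃ × eval x (monic (1 ∷ 1 ∷ [])) ≈ 0#)
    factor-root {x} outside allow₃ m (c ∷ [] , linear) _ root = ⊥-elim (outside t (begin
      toℕ t · 1#                      ≡⟨ ≡.cong (_· 1#) (FinP.toℕ-fromℕ< t<p) ⟩
      (((p ℕ.∸ 1) ℕ.* c) % p) · 1#    ≈⟨ ·1-% char _ ⟩
      ((p ℕ.∸ 1) ℕ.* c) · 1#          ≈⟨ [p-1]*n·1≈-n·1 char c ⟩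
      - (c · 1#)                      ≈⟨ +-inverseʳ-unique _ x c+x≈0 ⟨
      x                               ∎))
      where
      t<p = m%n<n ((p ℕ.∸ 1) ℕ.* c) p
      t = Fin.fromℕ< t<p
      c+x≈0 : c · 1# + x ≈ 0#
      c+x≈0 = trans (+-congˡ (sym (trans (*-congˡ (trans (eval-constant x 1) (+-identityʳ 1#))) (*-identityʳ x)))) root
    factor-root {x} outside allow₃ m (f , mapsTo g) ok root = inj₁ (eval x g , (begin
      eval (eval x g) (monic m)                                ≈⟨ eval-∘ᴾ x (monic m) g ⟨
      eval x (monic m ∘ᴾ g)
        ≈⟨ eval-normalForm char (root⇒power≈ char f root) (monic m ∘ᴾ g) ⟨
      eval x (normalForm (length f) (negate f) (monic m ∘ᴾ g))
        ≡⟨ ≡.cong (eval x) (toWitness {a? = normalForm (length f) (negate f) (monic m ∘ᴾ g) ≟ᴾ []} ok) ⟩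
      0#                                                       ∎))
    factor-root {x} outside true m (f , cyclotomic₃) ok root =
      inj₂ (_ , ≡.subst (λ f → eval x (monic f) ≈ 0#) (toWitness {a? = f ≟ᴾ 1 ∷ 1 ∷ []} ok) root)

    certified-root : ∀ {x} → OutsidePrimeField x → ∀ allow₃ m fs → T (certifies allow₃ q m fs) →
                     HasRoot m ⊎ (T allow₃ × eval x (monic (1 ∷ 1 ∷ [])) ≈ 0#)
    certified-root {x} outside allow₃ m fs ok = some-factor fs kinds (product-root x fs (begin
      eval x (product fs)                ≈⟨ eval-normalForm₀ char x (product fs) ⟨
      eval x (normalForm₀ (product fs))
        ≡⟨ ≡.cong (eval x) (toWitness {a? = normalForm₀ (product fs) ≟ᴾ normalForm₀ (X^q-X q)} same) ⟩
      eval x (normalForm₀ (X^q-X q))     ≈⟨ eval-normalForm₀ char x (X^q-X q) ⟩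
      eval x (X^q-X q)                   ≈⟨ eval-X^q-X x ⟩
      0#                                 ∎))
      where
      checks = Equivalence.to (T-∧ {⌊ normalForm₀ (product fs) ≟ᴾ normalForm₀ (X^q-X q) ⌋}) ok
      same = proj₁ checks
      kinds = proj₂ checks
      some-factor : ∀ fs → T (all (kindOK allow₃ m) fs) → Any (λ e → eval x (monic (proj₁ e)) ≈ 0#) fs →
                    HasRoot m ⊎ (T allow₃ × eval x (monic (1 ∷ 1 ∷ [])) ≈ 0#)
      some-factor (e ∷ fs) ok (here root) =
        factor-root outside allow₃ m e (proj₁ (Equivalence.to (T-∧ {kindOK allow₃ m e}) ok)) root
      some-factor (e ∷ fs) ok (there any) =
        some-factor fs (proj₂ (Equivalence.to (T-∧ {kindOK allow₃ m e}) ok)) any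

    root-of-certified : p < q → ∀ m fs → T (certifies false q m fs) → HasRoot m
    root-of-certified p<q m fs ok with outside-image (λ (t : Fin p) → toℕ t · 1#) p<q
    ... | x , outside with certified-root outside false m fs ok
    ...   | inj₁ root     = root
    ...   | inj₂ (() , _)

    plane : Carrier → Fin (p ℕ.* p) → Carrier
    plane β t = (toℕ t % p) · 1# + (toℕ t / p) · 1# * β

    point : ∀ i j → i < p → j < p → Fin (p ℕ.* p)
    point i j i<p j<p = Fin.fromℕ< (two-digits-< i<p j<p)

    plane-point : ∀ β {i j} (i<p : i < p) (j<p : j < p) → plane β (point i j i<p j<p) ≈ i · 1# + j · 1# * β
    plane-point β {i} {j} i<p j<p
      rewrite FinP.toℕ-fromℕ< (two-digits-< i<p j<p) | proj₁ (digit-split j i<p) | proj₂ (digit-split j i<p) = refl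

    outside-plane : ∀ β {x} → (∀ t → ¬ plane β t ≈ x) → OutsidePrimeField x
    outside-plane β outside t t≈x = outside (point (toℕ t) 0 (FinP.toℕ<n t) (IsCharacteristic.positive char))
      (trans (plane-point β (FinP.toℕ<n t) (IsCharacteristic.positive char))
             (trans (+-congˡ (zeroˡ β)) (trans (+-identityʳ _) t≈x)))

    -- The roots of X² + X + 1 lie in {i + j β : i, j < p} for a single root β, which misses some x when p² < q.
    root-of-certified₃ : p ℕ.* p < q → ∀ m fs → T (certifies true q m fs) → HasRoot m
    root-of-certified₃ p²<q m fs ok with outside-image (λ (t : Fin p) → toℕ t · 1#) p<q
      where p<q = ℕP.<-trans (ℕP.m<m*n p p (1<characteristic char isField)) p²<q
    ... | β , β-outside with certified-root β-outside true m fs ok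
    ...   | inj₁ root         = root
    ...   | inj₂ (_ , β-root) with outside-image (plane β) p²<q
    ...     | x , x-outside with certified-root (outside-plane β x-outside) true m fs ok
    ...       | inj₁ root         = root
    ...       | inj₂ (_ , x-root) with X²+X+1-roots (trans (sym (eval-X²+X+1 β)) β-root) (trans (sym (eval-X²+X+1 x)) x-root)
    ...         | inj₁ x≈β = ⊥-elim (x-outside (point 0 1 0<p 1<p) (begin
      plane β (point 0 1 0<p 1<p)     ≈⟨ plane-point β 0<p 1<p ⟩
      0# + (1# + 0#) * β              ≈⟨ trans (+-identityˡ _) (trans (*-congʳ (+-identityʳ 1#)) (*-identityˡ β)) ⟩
      β                               ≈⟨ x≈β ⟨
      x                               ∎))
      where
      1<p = 1<characteristic char isField
      0<p = ℕP.<-trans (s≤s z≤n) 1<p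
    ...         | inj₂ x+β+1≈0 = ⊥-elim (x-outside (point (p ℕ.∸ 1) (p ℕ.∸ 1) p-1<p p-1<p) (begin
      plane β (point (p ℕ.∸ 1) (p ℕ.∸ 1) p-1<p p-1<p)   ≈⟨ plane-point β p-1<p p-1<p ⟩
      (p ℕ.∸ 1) · 1# + (p ℕ.∸ 1) · 1# * β
        ≈⟨ +-cong ([p-1]·1≈-1 char) (trans (*-congʳ ([p-1]·1≈-1 char)) (-1*x≈-x β)) ⟩
      - 1# + - β                                        ≈⟨ -‿+-comm 1# β ⟩
      - (1# + β)                                        ≈⟨ -‿cong (+-comm 1# β) ⟩
      - (β + 1#)                                        ≈⟨ +-inverseʳ-unique (β + 1#) x (trans (+-comm _ x) x+β+1≈0) ⟨
      x                                                 ∎))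
      where
      open import Algebra.Properties.Ring ring using (-1*x≈-x; -‿+-comm)
      p-1<p = ℕP.∸-monoʳ-< {p} {1} {0} (s≤s z≤n) (IsCharacteristic.positive char)

-- Witnesses and the table for q ≤ 50

-- K as F_p, or as F_p[X]/(m) for m = monic (lower coefficients) with a certificate that m has a root
-- in K; adjoin₃ also admits the factor X² + X + 1 and needs p² < q.
data Extension : Set where
  prime-field : Extension
  adjoin      : Poly → Factorisation → Extension
  adjoin₃     : Poly → Factorisation → Extension

modulus : Extension → Poly
modulus prime-field    = 0 ∷ []
modulus (adjoin  m _)  = m
modulus (adjoin₃ m _)  = m

record Witness : Set where
  constructor witness
  field
    extension : Extension
    triple    : Poly × Poly × Poly
    copies    : ℕ

candidate : Witness → List Poly
candidate (witness _ (a , b , c) n) = concat (replicate n (a ∷ b ∷ c ∷ []))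

rootCertified : (p : ℕ) .{{_ : NonZero p}} → ℕ → Extension → Bool
rootCertified p q prime-field     = true
rootCertified p q (adjoin  m fs)  = (p ℕ.<ᵇ q) ∧ FactorisationCheck.certifies p false q m fs
rootCertified p q (adjoin₃ m fs)  = (p ℕ.* p ℕ.<ᵇ q) ∧ FactorisationCheck.certifies p true q m fs

longEnough : ℕ → ℕ → ℕ → Bool
longEnough p q n = if ⌊ p ℕP.≟ 2 ⌋ then 3 ℕ.* (q ℕ.∸ 1) ℕ.≤ᵇ n else 3 ℕ.* (q ℕ.∸ 1) ℕ.≤ᵇ 2 ℕ.* n

valid : ℕ → ℕ → Witness → Bool
valid zero      q w = false
valid p@(suc _) q w =
  (1 ℕ.≤ᵇ Witness.copies w) ∧
  (rootCertified p q ext ∧ (isQuiddityʳ L ∧ (noSignCornerSplitʳ 3 L ∧ longEnough p q (length L))))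
  where
  ext = Witness.extension w
  L = candidate w
  open QuotientArithmetic p (length (modulus ext)) (Modular.negate p (modulus ext))

module WitnessSoundness {c ℓ} (K : CommutativeRing c ℓ) (isField : IsField K) {q} (card : HasCardinality K q) where
  open Characteristic K
  open Evaluation K
  open Roots K isField card

  LongEnough : ℕ → Set ℓ
  LongEnough n = (Char2 K → 3 ℕ.* (q ℕ.∸ 1) ≤ n) × (¬ Char2 K → 3 ℕ.* (q ℕ.∸ 1) ≤ 2 ℕ.* n)

  longEnough-sound : ∀ {p} → IsCharacteristic p → ∀ n → T (longEnough p q n) → LongEnough n
  longEnough-sound {p} char n ok with p ℕP.≟ 2
  ... | yes p≡2 = (λ _ → ℕP.≤ᵇ⇒≤ _ _ ok) , λ ¬char2 → ⊥-elim (¬char2 (p≡2⇒Char2 char p≡2))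
  ... | no  p≢2 = (λ char2 → ⊥-elim (p≢2 (Char2⇒p≡2 char isField char2))) , λ _ → ℕP.≤ᵇ⇒≤ _ _ ok

  module _ {p} (char : IsCharacteristic p) where

    rootCertified-sound : ∀ ext → T (rootCertified p {{p-nonZero char}} q ext) → HasRoot (modulus ext)
    rootCertified-sound prime-field _ = X-has-root
    rootCertified-sound (adjoin m fs) ok with Equivalence.to (T-∧ {p ℕ.<ᵇ q}) ok
    ... | p<q , certified = root-of-certified char (ℕP.<ᵇ⇒< p q p<q) m fs certified
    rootCertified-sound (adjoin₃ m fs) ok with Equivalence.to (T-∧ {p ℕ.* p ℕ.<ᵇ q}) ok
    ... | p²<q , certified = root-of-certified₃ char (ℕP.<ᵇ⇒< (p ℕ.* p) q p²<q) m fs certified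

  -- n stays abstract here: unfolding the repeated triple would make the checks reduce symbolically.
  valid-sound : ∀ {p} → IsCharacteristic p → ∀ w → T (valid p q w) →
                ∃[ cs ] (IsIrreducibleQuiddity K cs × LongEnough (length cs))
  valid-sound {p@(suc _)} char w@(witness ext (a , b , c) n) ok =
    map ψ L , irreducible-quiddity L 3 period period′ (3≤length n 1≤n) quiddity noSplit ,
    ≡.subst LongEnough (≡.sym (ListP.length-map ψ L)) (longEnough-sound char (length L) long)
    where
    m = modulus ext
    t = a ∷ b ∷ c ∷ []
    L = concat (replicate n t)
    open QuotientArithmetic p (length m) (Modular.negate p m)
    split = Equivalence.to (T-∧ {1 ℕ.≤ᵇ n}) ok
    1≤n = ℕP.≤ᵇ⇒≤ 1 n (proj₁ split)
    split′ = Equivalence.to (T-∧ {rootCertified p q ext}) (proj₂ split)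
    checks = Equivalence.to (T-∧ {isQuiddityʳ L}) (proj₂ split′)
    quiddity = proj₁ checks
    checks′ = Equivalence.to (T-∧ {noSignCornerSplitʳ 3 L}) (proj₂ checks)
    noSplit = proj₁ checks′
    long = proj₂ checks′
    root = rootCertified-sound char ext (proj₁ split′)
    α^k≈r = root⇒power≈ char m (proj₂ root)
    ψ = QuotientEvaluation.ψ K isField char {length m} {Modular.negate p m} α^k≈r
    irreducible-quiddity = QuotientEvaluation.irreducible-quiddity K isField char {length m} {Modular.negate p m} α^k≈r
    3≤length : ∀ n → 1 ≤ n → 3 ≤ length (concat (replicate n t))
    3≤length (suc n) _ = s≤s (s≤s (s≤s z≤n))
    period : rotation 3 L ≡ L
    period = rotation-concat-replicate n t
    period′ : rotation 3 (reverse L) ≡ reverse L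
    period′ = ≡.trans (≡.cong (rotation 3) (reverse-concat-replicate n t))
               (≡.trans (rotation-concat-replicate n (reverse t)) (≡.sym (reverse-concat-replicate n t)))

factorisation₄ : Factorisation
factorisation₄ =
    (0 ∷ [] , linear)
  ∷ (1 ∷ [] , linear)
  ∷ (1 ∷ 1 ∷ [] , mapsTo (0 ∷ 1 ∷ []))
  ∷ []

factorisation₈ : Factorisation
factorisation₈ =
    (0 ∷ [] , linear)
  ∷ (1 ∷ [] , linear)
  ∷ (1 ∷ 0 ∷ 1 ∷ [] , mapsTo (0 ∷ 0 ∷ 1 ∷ []))
  ∷ (1 ∷ 1 ∷ 0 ∷ [] , mapsTo (1 ∷ 0 ∷ 1 ∷ []))
  ∷ []

factorisation₉ : Factorisation
factorisation₉ =
    (0 ∷ [] , linear)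
  ∷ (1 ∷ [] , linear)
  ∷ (2 ∷ [] , linear)
  ∷ (1 ∷ 0 ∷ [] , mapsTo (0 ∷ 1 ∷ []))
  ∷ (2 ∷ 1 ∷ [] , mapsTo (1 ∷ 2 ∷ []))
  ∷ (2 ∷ 2 ∷ [] , mapsTo (1 ∷ 1 ∷ []))
  ∷ []

factorisation₁₆ : Factorisation
factorisation₁₆ =
    (0 ∷ [] , linear)
  ∷ (1 ∷ [] , linear)
  ∷ (1 ∷ 1 ∷ [] , cyclotomic₃)
  ∷ (1 ∷ 0 ∷ 0 ∷ 1 ∷ [] , mapsTo (0 ∷ 0 ∷ 1 ∷ []))
  ∷ (1 ∷ 1 ∷ 0 ∷ 0 ∷ [] , mapsTo (0 ∷ 1 ∷ 1 ∷ 1 ∷ []))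
  ∷ (1 ∷ 1 ∷ 1 ∷ 1 ∷ [] , mapsTo (0 ∷ 1 ∷ 1 ∷ 1 ∷ []))
  ∷ []

factorisation₂₅ : Factorisation
factorisation₂₅ =
    (0 ∷ [] , linear)
  ∷ (1 ∷ [] , linear)
  ∷ (2 ∷ [] , linear)
  ∷ (3 ∷ [] , linear)
  ∷ (4 ∷ [] , linear)
  ∷ (1 ∷ 1 ∷ [] , mapsTo (0 ∷ 1 ∷ []))
  ∷ (1 ∷ 4 ∷ [] , mapsTo (0 ∷ 4 ∷ []))
  ∷ (2 ∷ 0 ∷ [] , mapsTo (2 ∷ 1 ∷ []))
  ∷ (2 ∷ 1 ∷ [] , mapsTo (1 ∷ 3 ∷ []))
  ∷ (2 ∷ 4 ∷ [] , mapsTo (1 ∷ 2 ∷ []))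
  ∷ (3 ∷ 0 ∷ [] , mapsTo (2 ∷ 2 ∷ []))
  ∷ (3 ∷ 2 ∷ [] , mapsTo (1 ∷ 4 ∷ []))
  ∷ (3 ∷ 3 ∷ [] , mapsTo (1 ∷ 1 ∷ []))
  ∷ (4 ∷ 2 ∷ [] , mapsTo (0 ∷ 3 ∷ []))
  ∷ (4 ∷ 3 ∷ [] , mapsTo (0 ∷ 2 ∷ []))
  ∷ []

factorisation₂₇ : Factorisation
factorisation₂₇ =
    (0 ∷ [] , linear)
  ∷ (1 ∷ [] , linear)
  ∷ (2 ∷ [] , linear)
  ∷ (1 ∷ 0 ∷ 2 ∷ [] , mapsTo (0 ∷ 1 ∷ []))
  ∷ (1 ∷ 1 ∷ 2 ∷ [] , mapsTo (0 ∷ 0 ∷ 2 ∷ []))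
  ∷ (1 ∷ 2 ∷ 0 ∷ [] , mapsTo (0 ∷ 1 ∷ 2 ∷ []))
  ∷ (1 ∷ 2 ∷ 1 ∷ [] , mapsTo (0 ∷ 2 ∷ 1 ∷ []))
  ∷ (2 ∷ 0 ∷ 1 ∷ [] , mapsTo (0 ∷ 2 ∷ []))
  ∷ (2 ∷ 1 ∷ 1 ∷ [] , mapsTo (0 ∷ 0 ∷ 2 ∷ []))
  ∷ (2 ∷ 2 ∷ 0 ∷ [] , mapsTo (0 ∷ 1 ∷ 2 ∷ []))
  ∷ (2 ∷ 2 ∷ 2 ∷ [] , mapsTo (0 ∷ 1 ∷ 1 ∷ []))
  ∷ []

factorisation₃₂ : Factorisation
factorisation₃₂ =
    (0 ∷ [] , linear)
  ∷ (1 ∷ [] , linear)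
  ∷ (1 ∷ 0 ∷ 0 ∷ 1 ∷ 0 ∷ [] , mapsTo (0 ∷ 0 ∷ 0 ∷ 0 ∷ 1 ∷ []))
  ∷ (1 ∷ 0 ∷ 1 ∷ 0 ∷ 0 ∷ [] , mapsTo (0 ∷ 1 ∷ 0 ∷ 0 ∷ 1 ∷ []))
  ∷ (1 ∷ 0 ∷ 1 ∷ 1 ∷ 1 ∷ [] , mapsTo (0 ∷ 1 ∷ 0 ∷ 1 ∷ []))
  ∷ (1 ∷ 1 ∷ 0 ∷ 1 ∷ 1 ∷ [] , mapsTo (0 ∷ 0 ∷ 1 ∷ 0 ∷ 1 ∷ []))
  ∷ (1 ∷ 1 ∷ 1 ∷ 0 ∷ 1 ∷ [] , mapsTo (0 ∷ 0 ∷ 0 ∷ 1 ∷ []))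
  ∷ (1 ∷ 1 ∷ 1 ∷ 1 ∷ 0 ∷ [] , mapsTo (0 ∷ 0 ∷ 1 ∷ 0 ∷ 1 ∷ []))
  ∷ []

factorisation₄₉ : Factorisation
factorisation₄₉ =
    (0 ∷ [] , linear)
  ∷ (1 ∷ [] , linear)
  ∷ (2 ∷ [] , linear)
  ∷ (3 ∷ [] , linear)
  ∷ (4 ∷ [] , linear)
  ∷ (5 ∷ [] , linear)
  ∷ (6 ∷ [] , linear)
  ∷ (1 ∷ 0 ∷ [] , mapsTo (0 ∷ 1 ∷ []))
  ∷ (1 ∷ 3 ∷ [] , mapsTo (1 ∷ 3 ∷ []))
  ∷ (1 ∷ 4 ∷ [] , mapsTo (1 ∷ 4 ∷ []))
  ∷ (2 ∷ 0 ∷ [] , mapsTo (0 ∷ 2 ∷ []))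
  ∷ (2 ∷ 2 ∷ [] , mapsTo (1 ∷ 1 ∷ []))
  ∷ (2 ∷ 5 ∷ [] , mapsTo (1 ∷ 6 ∷ []))
  ∷ (3 ∷ 1 ∷ [] , mapsTo (3 ∷ 6 ∷ []))
  ∷ (3 ∷ 2 ∷ [] , mapsTo (2 ∷ 2 ∷ []))
  ∷ (3 ∷ 5 ∷ [] , mapsTo (2 ∷ 5 ∷ []))
  ∷ (3 ∷ 6 ∷ [] , mapsTo (3 ∷ 1 ∷ []))
  ∷ (4 ∷ 0 ∷ [] , mapsTo (0 ∷ 3 ∷ []))
  ∷ (4 ∷ 1 ∷ [] , mapsTo (1 ∷ 2 ∷ []))
  ∷ (4 ∷ 6 ∷ [] , mapsTo (1 ∷ 5 ∷ []))
  ∷ (5 ∷ 2 ∷ [] , mapsTo (3 ∷ 3 ∷ []))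
  ∷ (5 ∷ 3 ∷ [] , mapsTo (2 ∷ 6 ∷ []))
  ∷ (5 ∷ 4 ∷ [] , mapsTo (2 ∷ 1 ∷ []))
  ∷ (5 ∷ 5 ∷ [] , mapsTo (3 ∷ 4 ∷ []))
  ∷ (6 ∷ 1 ∷ [] , mapsTo (2 ∷ 4 ∷ []))
  ∷ (6 ∷ 3 ∷ [] , mapsTo (3 ∷ 2 ∷ []))
  ∷ (6 ∷ 4 ∷ [] , mapsTo (3 ∷ 5 ∷ []))
  ∷ (6 ∷ 6 ∷ [] , mapsTo (2 ∷ 3 ∷ []))
  ∷ []

witnesses : List (ℕ × Witness)
witnesses =
    (2 , witness prime-field (1 ∷ [] , 1 ∷ [] , 1 ∷ []) 1)
  ∷ (3 , witness prime-field (1 ∷ [] , 1 ∷ [] , 1 ∷ []) 1)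
  ∷ (4 , witness (adjoin (1 ∷ 1 ∷ []) factorisation₄) (0 ∷ 1 ∷ [] , 0 ∷ 1 ∷ [] , 1 ∷ 1 ∷ []) 3)
  ∷ (5 , witness prime-field (2 ∷ [] , 2 ∷ [] , 3 ∷ []) 2)
  ∷ (7 , witness prime-field (2 ∷ [] , 2 ∷ [] , 4 ∷ []) 3)
  ∷ (8 , witness (adjoin (1 ∷ 0 ∷ 1 ∷ []) factorisation₈) (0 ∷ 1 ∷ [] , 0 ∷ 1 ∷ [] , 0 ∷ 1 ∷ 1 ∷ []) 7)
  ∷ (9 , witness (adjoin (1 ∷ 0 ∷ []) factorisation₉) (0 ∷ 1 ∷ [] , 1 ∷ 1 ∷ [] , 2 ∷ 1 ∷ []) 4)
  ∷ (11 , witness prime-field (2 ∷ [] , 2 ∷ [] , 6 ∷ []) 5)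
  ∷ (13 , witness prime-field (2 ∷ [] , 6 ∷ [] , 11 ∷ []) 6)
  ∷ (16 , witness (adjoin₃ (1 ∷ 0 ∷ 0 ∷ 1 ∷ []) factorisation₁₆) (0 ∷ 1 ∷ [] , 0 ∷ 1 ∷ [] , 0 ∷ 0 ∷ 1 ∷ 1 ∷ []) 15)
  ∷ (17 , witness prime-field (3 ∷ [] , 3 ∷ [] , 6 ∷ []) 8)
  ∷ (19 , witness prime-field (2 ∷ [] , 10 ∷ [] , 10 ∷ []) 9)
  ∷ (23 , witness prime-field (2 ∷ [] , 2 ∷ [] , 12 ∷ []) 11)
  ∷ (25 , witness (adjoin (1 ∷ 1 ∷ []) factorisation₂₅) (2 ∷ 1 ∷ [] , 2 ∷ 1 ∷ [] , 2 ∷ 3 ∷ []) 12)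
  ∷ (27 , witness (adjoin (1 ∷ 0 ∷ 2 ∷ []) factorisation₂₇) (0 ∷ 1 ∷ [] , 0 ∷ 1 ∷ [] , 0 ∷ 1 ∷ 2 ∷ []) 13)
  ∷ (29 , witness prime-field (2 ∷ [] , 2 ∷ [] , 15 ∷ []) 14)
  ∷ (31 , witness prime-field (3 ∷ [] , 3 ∷ [] , 21 ∷ []) 15)
  ∷ (32 , witness (adjoin (1 ∷ 0 ∷ 0 ∷ 1 ∷ 0 ∷ []) factorisation₃₂) (1 ∷ 1 ∷ [] , 1 ∷ 1 ∷ [] , 0 ∷ 0 ∷ 0 ∷ 1 ∷ 1 ∷ []) 31)
  ∷ (37 , witness prime-field (2 ∷ [] , 2 ∷ [] , 19 ∷ []) 18)
  ∷ (41 , witness prime-field (6 ∷ [] , 6 ∷ [] , 7 ∷ []) 20)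
  ∷ (43 , witness prime-field (3 ∷ [] , 3 ∷ [] , 29 ∷ []) 21)
  ∷ (47 , witness prime-field (2 ∷ [] , 13 ∷ [] , 24 ∷ []) 23)
  ∷ (49 , witness (adjoin (1 ∷ 0 ∷ []) factorisation₄₉) (2 ∷ 1 ∷ [] , 2 ∷ 1 ∷ [] , 6 ∷ 4 ∷ []) 24)
  ∷ []

witnessFor : ℕ → Witness
witnessFor q = maybe′ proj₂ (witness prime-field ([] , [] , []) 0) (find (λ e → proj₁ e ℕP.≟ q) witnesses)

ValidUpTo : ℕ → ℕ → Set
ValidUpTo P J = ∀ {p} → p < P → Prime p → ∀ {j} → j < J → p ℕ.^ suc j ℕ.≤ 50 →
                T (valid p (p ℕ.^ suc j) (witnessFor (p ℕ.^ suc j)))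

validUpTo? : ∀ P J → Dec (ValidUpTo P J)
validUpTo? P J = ℕP.allUpTo? (λ p → prime? p →-dec ℕP.allUpTo? (λ j → (p ℕ.^ suc j ℕP.≤? 50) →-dec
                   T? (valid p (p ℕ.^ suc j) (witnessFor (p ℕ.^ suc j)))) J) P

-- Opaque: unfolding this proof would rerun the decision procedure inside later conversion checks.
opaque
  small-prime-powers-valid : ∀ {p j} → Prime p → p ℕ.^ suc j ℕ.≤ 50 →
                             T (valid p (p ℕ.^ suc j) (witnessFor (p ℕ.^ suc j)))
  small-prime-powers-valid {p} {j} p-prime bound = toWitness {a? = validUpTo? 51 50} tt p<51 p-prime j<50 bound
    where
    p<51 : p < 51
    p<51 = s≤s (ℕP.≤-trans (ℕP.m≤m*n p (p ℕ.^ j) {{ℕP.m^n≢0 p j {{prime⇒nonZero p-prime}}}}) bound)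
    j<50 : j < 50
    j<50 = ℕP.<-trans (ℕP.n<1+n j) (ℕP.<-≤-trans (n<m^n (ℕ.nonTrivial⇒n>1 p {{prime⇒nonTrivial p-prime}}) (suc j)) bound)


-- ℕ's _*_ is opened only here: the modules above use the ring multiplication of K.
open import Data.Nat using (_*_; _∸_)

proposition6p16 : ∀ {c ℓ} (K : CommutativeRing c ℓ) (q : ℕ) →
    IsField K → HasCardinality K q → q ≤ 50 →
    (Char2 K → ℓ≥ K (3 * (q ∸ 1))) ×
    (¬ Char2 K → ∃[ cs ] (IsIrreducibleQuiddity K cs × 3 * (q ∸ 1) ≤ 2 * length cs))
proposition6p16 K q isField card q≤50 with FiniteField.prime-power K isField card
... | p , j , char , p-prime , ≡.refl
  with WitnessSoundness.valid-sound K isField card char (witnessFor q) (small-prime-powers-valid {p} {j} p-prime q≤50)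
...   | cs , irreducible , long₂ , long =
  (λ char2 → cs , irreducible , long₂ char2) , (λ ¬char2 → cs , irreducible , long ¬char2)
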